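{- Let $D$ be a binary delta-matroid in which the empty set is feasible. Then there is a sequence of handle slides taking $D$ to $D_{i,j,k}$ for some non-negative integers $i,j,k$.
   Context: A delta-matroid is a set system $(E,\mathcal{F})$ ($E$ finite, $\mathcal{F}$ non-empty) such that for all $X,Y\in\mathcal{F}$ and $u\in X\triangle Y$ there is $v\in X\triangle Y$ with $X\triangle\{u,v\}\in\mathcal{F}$. For a symmetric matrix $M$ over $GF(2)$ indexed by $E$, $D(M)$ has feasible sets the $A\subseteq E$ with $M[A]$ non-singular ($M[\emptyset]$ non-singular by convention). The twist is $D*A=(E,\{A\triangle X:X\in\mathcal{F}\})$; $D$ is binary if some twist of it is isomorphic to some $D(M)$ over $GF(2)$. Handle slide of $a$ over $b$ ($a\ne b$): $D_{ab}=(E,\mathcal{F}\triangle\{X\cup\{a\}: X\cup\{b\}\in\mathcal{F},\ X\subseteq E\setminus\{a,b\}\})$; a sequence of handle slides is an iteration of these. $D_{i,j,k}$ is the direct sum (ground sets disjoint unions, feasible sets unions of feasible sets of the summands) of $i$ copies of $(\{e\},\{\emptyset\})$, $j$ copies of $(\{e,f\},\{\emptyset,\{e,f\}\})$ and $k$ copies of $(\{e\},\{\emptyset,\{e\}\})$, with ground set identified with $E$. -}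

module Defs where

open import Data.Nat using (ℕ; zero; suc; _+_; _*_)
open import Data.Bool using (Bool; true; false; _xor_; _∧_; not; _≟_)
open import Data.Fin using (Fin)
import Data.Fin as Fin
open import Data.Fin.Subset using (Subset; _∈_; _∪_; ⁅_⁆; ⊥; _⊆_)
open import Data.Vec using (Vec; []; _∷_; lookup; tabulate; zipWith; take; drop; _[_]≔_; foldr′)
open import Data.Product using (Σ; ∃; ∃-syntax; _×_; _,_)
open import Relation.Binary.PropositionalEquality using (_≡_)
open import Relation.Nullary using (¬_)
open import Function.Bundles using (_⇔_; _↔_; Inverse)
open import Relation.Binary.Construct.Closure.ReflexiveTransitive using (Star)

Family : ℕ → Set
Family n = Subset n → Bool

Feasible : ∀ {n} → Family n → Subset n → Set
Feasible F X = F X ≡ true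

_△_ : ∀ {n} → Subset n → Subset n → Subset n
_△_ = zipWith _xor_

-- delta-matroid: non-empty family + symmetric exchange axiom
-- ({u,v} is written ⁅ u ⁆ ∪ ⁅ v ⁆, which is {u} when u = v)
IsDeltaMatroid : ∀ {n} → Family n → Set
IsDeltaMatroid {n} F =
  (∃[ X ] Feasible F X) ×
  (∀ (X Y : Subset n) (u : Fin n) → Feasible F X → Feasible F Y → u ∈ X △ Y →
     ∃[ v ] (v ∈ X △ Y × Feasible F (X △ (⁅ u ⁆ ∪ ⁅ v ⁆))))

twist : ∀ {n} → Family n → Subset n → Family n
twist F A Y = F (A △ Y)

image : ∀ {n m} → (Fin n ↔ Fin m) → Subset n → Subset m
image σ X = tabulate (λ j → lookup X (Inverse.from σ j))

-- GF(2) matrices indexed by Fin n (Bool = GF(2): xor is +, ∧ is ·)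
Matrix : ℕ → Set
Matrix n = Fin n → Fin n → Bool

Symmetric : ∀ {n} → Matrix n → Set
Symmetric M = ∀ i j → M i j ≡ M j i

rowDot : ∀ {n} → Matrix n → Fin n → Subset n → Bool
rowDot {n} M i x = foldr′ _xor_ false (tabulate (λ j → M i j ∧ lookup x j))

-- M[A] is non-singular: its null space is trivial, i.e. the only vector x
-- supported on A with (M x)_i = 0 for all i ∈ A is x = 0.
-- (For A = ∅ this holds vacuously, matching the convention.)
Nonsingular : ∀ {n} → Matrix n → Subset n → Set
Nonsingular {n} M A =
  ∀ (x : Subset n) → x ⊆ A → (∀ i → i ∈ A → rowDot M i x ≡ false) → x ≡ ⊥

Binary : ∀ {n} → Family n → Set
Binary {n} F =
  Σ (Subset n) λ A → Σ (Matrix n) λ M → Symmetric M ×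
    Σ (Fin n ↔ Fin n) λ σ → ∀ (X : Subset n) → (Feasible (twist F A) X ⇔ Nonsingular M (image σ X))

-- handle slide of a over b:
-- F_ab = F △ { X ∪ {a} : X ∪ {b} ∈ F, X ⊆ E ∖ {a,b} }
-- Y lies in the second family iff a ∈ Y, b ∉ Y and (Y with a removed, b added) ∈ F.
slide : ∀ {n} → Fin n → Fin n → Family n → Family n
slide a b F Y = F Y xor (lookup Y a ∧ (not (lookup Y b) ∧ F ((Y [ a ]≔ false) [ b ]≔ true)))

SlideStep : ∀ {n} → Family n → Family n → Set
SlideStep {n} F G = Σ (Fin n) λ a → Σ (Fin n) λ b → ¬ (a ≡ b) × G ≡ slide a b F

Slides : ∀ {n} → Family n → Family n → Set
Slides = Star SlideStep

Isomorphic : ∀ {n m} → Family n → Family m → Set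
Isomorphic {n} {m} F G = Σ (Fin n ↔ Fin m) λ σ → ∀ (X : Subset n) → F X ≡ G (image σ X)

_⊕_ : ∀ {n m} → Family n → Family m → Family (n + m)
_⊕_ {n} F G X = F (take n X) ∧ G (drop n X)

emptyFam : Family 0
emptyFam _ = true

copies : ∀ {s} (k : ℕ) → Family s → Family (k * s)
copies zero    F = emptyFam
copies (suc k) F = F ⊕ copies k F

loopFam : Family 1
loopFam X = not (lookup X Fin.zero)

pairFam : Family 2
pairFam X = not (lookup X Fin.zero xor lookup X (Fin.suc Fin.zero))

freeFam : Family 1
freeFam _ = true

D[_,_,_] : (i j k : ℕ) → Family (i * 1 + (j * 2 + k * 1))
D[ i , j , k ] = copies i loopFam ⊕ (copies j pairFam ⊕ copies k freeFam)

module Submission where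

-- Set systems are handled through linear algebra over GF(2): for a self-adjoint
-- linear map f of GF(2)ⁿ (a symmetric matrix), D f consists of the sets Z on
-- which the principal submatrix f[Z] is nonsingular.  The interesting case a ∈ Y, b ∉ Y is
--     a parity argument: kernel vectors for Y, for Y - a + b and for the slid map
--     on Y are detected by three lines in the coordinates (z_a, z_b, (f z)_a, (f z)_b),
--     and an exchange law forces an odd number of them to be hit.
--  3. Normal form: slides act on the matrix by simultaneous row and column
--     operations; they clear the first row except for a diagonal 1 (free
--     element), nothing (loop) or a block (0 1; 1 0) (pair), which then splits off
--     as a direct summand.  Induction on the size, together with relabellings of
--     the ground set, reaches a family isomorphic to some D[ i , j , k ].
--  4. The theorem: the binary representation of a twist, pivoted on the twisting
--     set, represents the system itself; apply 3 and transport along the relabelling.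

open import Defs
open import Data.Nat using (ℕ; zero; suc; _+_; _*_; _≤_)
import Data.Nat.Properties as ℕP
open import Data.Bool using (Bool; true; false; _xor_; _∧_; _∨_; not; if_then_else_)
import Data.Bool as B
import Data.Bool.Properties as BP
open import Data.Fin as Fin using (Fin; zero; suc; _↑ˡ_; _↑ʳ_)
import Data.Fin.Properties as FinP
open import Data.Fin.Subset using (⊥; ⁅_⁆; ∣_∣)
open import Data.Fin.Subset.Properties using (x∈⁅x⁆; x≢y⇒x∉⁅y⁆; anySubset?; ∣p∣≤n)
open import Data.Vec using (Vec; []; _∷_; lookup; tabulate; _++_; foldr′; _[_]≔_; take; drop)
open import Algebra.Bundles using (CommutativeRing)
import Data.Vec.Properties as VecP
open import Data.List as List using (List; []; _∷_; allFin)
open import Data.List.Membership.Propositional.Properties using (∈-map⁺; ∈-allFin)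
import Data.List.Relation.Unary.All.Properties as All
open import Data.List.Membership.Propositional using (_∈_; _∉_)
import Data.List.Membership.DecPropositional as DecMembership
open import Data.List.Relation.Unary.Any using (here; there)
open import Data.List.Relation.Unary.All as All using (All; []; _∷_)
open import Relation.Binary.Construct.Closure.ReflexiveTransitive using (ε; _◅_; _◅◅_)
open import Data.Fin.Permutation as Perm using (Permutation; _∘ₚ_; lift₀; _⟨$⟩ˡ_; _⟨$⟩ʳ_)
open import Function.Bundles using (Equivalence)
open import Data.Product using (Σ; ∃; _×_; _,_; proj₁; proj₂; uncurry)
open import Data.Sum using (_⊎_; inj₁; inj₂)
open import Data.Empty using () renaming (⊥ to Empty; ⊥-elim to absurd)
open import Function using (_∘_)
open import Relation.Binary.PropositionalEquality
open import Relation.Nullary using (¬_; Dec; yes; no; does)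
open import Relation.Nullary.Decidable using (True; toWitness; map′; _×-dec_; _→-dec_)

BoolFun : ℕ → Set
BoolFun zero    = Bool
BoolFun (suc k) = Bool → BoolFun k

Identity : ∀ k → BoolFun k → BoolFun k → Set
Identity zero    φ ψ = φ ≡ ψ
Identity (suc k) φ ψ = ∀ x → Identity k (φ x) (ψ x)

identity? : ∀ k (φ ψ : BoolFun k) → Dec (Identity k φ ψ)
identity? zero    φ ψ = φ B.≟ ψ
identity? (suc k) φ ψ =
  map′ (uncurry λ t f → λ { true → t ; false → f }) (λ h → h true , h false)
       (identity? k (φ true) (ψ true) ×-dec identity? k (φ false) (ψ false))

-- The two sides are inferred from the expected type, e.g.
-- 'lemma : ∀ a b → a ∧ b ≡ b ∧ a ; lemma = byTruthTable 2'.
byTruthTable : ∀ k {φ ψ : BoolFun k} {_ : True (identity? k φ ψ)} → Identity k φ ψ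
byTruthTable k {_} {_} {t} = toWitness t

true≢false : true ≡ false → Empty
true≢false ()

module GF2 = CommutativeRing BP.xor-∧-commutativeRing
open import Algebra.Properties.CommutativeSemigroup GF2.+-commutativeSemigroup
  using () renaming (interchange to xor-interchange)

Vector : ℕ → Set
Vector n = Vec Bool n

infix 4 _≐_
_≐_ : ∀ {n} → Vector n → Vector n → Set
u ≐ w = ∀ i → lookup u i ≡ lookup w i

≐⇒≡ : ∀ {n} {u w : Vector n} → u ≐ w → u ≡ w
≐⇒≡ {u = u} {w} p =
  trans (sym (VecP.tabulate∘lookup u)) (trans (VecP.tabulate-cong p) (VecP.tabulate∘lookup w))

lookup-△ : ∀ {n} (u w : Vector n) i → lookup (u △ w) i ≡ lookup u i xor lookup w i
lookup-△ u w i = VecP.lookup-zipWith _xor_ i u w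

lookup-⊥ : ∀ {n} (i : Fin n) → lookup (⊥ {n}) i ≡ false
lookup-⊥ i = VecP.lookup-replicate i false

lookup-unit-≡ : ∀ {n} (a : Fin n) → lookup ⁅ a ⁆ a ≡ true
lookup-unit-≡ a = VecP.[]=⇒lookup (x∈⁅x⁆ a)

lookup-unit-≢ : ∀ {n} {a i : Fin n} → a ≢ i → lookup ⁅ a ⁆ i ≡ false
lookup-unit-≢ {a = a} {i} a≢i =
  BP.¬-not (λ e → x≢y⇒x∉⁅y⁆ (a≢i ∘ sym) (VecP.lookup⇒[]= i ⁅ a ⁆ e))

△-identityʳ : ∀ {n} (u : Vector n) → u △ ⊥ ≡ u
△-identityʳ u = ≐⇒≡ λ i → trans (lookup-△ u ⊥ i) (trans (cong (lookup u i xor_) (lookup-⊥ i)) (BP.xor-identityʳ _))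

△-identityˡ : ∀ {n} (u : Vector n) → ⊥ △ u ≡ u
△-identityˡ u = ≐⇒≡ λ i → trans (lookup-△ ⊥ u i) (cong (_xor lookup u i) (lookup-⊥ i))

△-self : ∀ {n} (u : Vector n) → u △ u ≡ ⊥
△-self u = ≐⇒≡ λ i → trans (lookup-△ u u i) (trans (BP.xor-same (lookup u i)) (sym (lookup-⊥ i)))

△-assoc : ∀ {n} (u v w : Vector n) → (u △ v) △ w ≡ u △ (v △ w)
△-assoc u v w = ≐⇒≡ λ i → begin
  lookup ((u △ v) △ w) i                      ≡⟨ lookup-△ (u △ v) w i ⟩
  lookup (u △ v) i xor lookup w i             ≡⟨ cong (_xor lookup w i) (lookup-△ u v i) ⟩
  (lookup u i xor lookup v i) xor lookup w i  ≡⟨ BP.xor-assoc (lookup u i) _ _ ⟩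
  lookup u i xor (lookup v i xor lookup w i)  ≡⟨ cong (lookup u i xor_) (sym (lookup-△ v w i)) ⟩
  lookup u i xor lookup (v △ w) i             ≡⟨ sym (lookup-△ u (v △ w) i) ⟩
  lookup (u △ (v △ w)) i                      ∎
  where open ≡-Reasoning

△-cancelˡ : ∀ {n} (u v : Vector n) → u △ (u △ v) ≡ v
△-cancelˡ u v = trans (sym (△-assoc u u v)) (trans (cong (_△ v) (△-self u)) (△-identityˡ v))

scale : ∀ {n} → Bool → Vector n → Vector n
scale true  u = u
scale false u = ⊥

lookup-scale : ∀ {n} c (u : Vector n) i → lookup (scale c u) i ≡ c ∧ lookup u i
lookup-scale true  u i = refl
lookup-scale false u i = lookup-⊥ i

-- select S u v takes its coordinates in S from v and the remaining ones from u;
-- it describes the exchange of coordinates performed by a principal pivot.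
select : ∀ {n} → Vector n → Vector n → Vector n → Vector n
select []      []      []      = []
select (s ∷ S) (x ∷ u) (y ∷ v) = (if s then y else x) ∷ select S u v

lookup-select : ∀ {n} (S u v : Vector n) i →
  lookup (select S u v) i ≡ (if lookup S i then lookup v i else lookup u i)
lookup-select (s ∷ S) (x ∷ u) (y ∷ v) zero    = refl
lookup-select (s ∷ S) (x ∷ u) (y ∷ v) (suc i) = lookup-select S u v i

dot : ∀ {n} → Vector n → Vector n → Bool
dot []      []      = false
dot (x ∷ u) (y ∷ v) = (x ∧ y) xor dot u v

dot-△ˡ : ∀ {n} (u w v : Vector n) → dot (u △ w) v ≡ dot u v xor dot w v
dot-△ˡ []      []      []      = refl
dot-△ˡ (x ∷ u) (y ∷ w) (z ∷ v) rewrite dot-△ˡ u w v = regroup x y z (dot u v) (dot w v)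
  where
  regroup : ∀ x y z a b → ((x xor y) ∧ z) xor (a xor b) ≡ ((x ∧ z) xor a) xor ((y ∧ z) xor b)
  regroup = byTruthTable 5

dot-comm : ∀ {n} (u v : Vector n) → dot u v ≡ dot v u
dot-comm []      []      = refl
dot-comm (x ∷ u) (y ∷ v) = cong₂ _xor_ (BP.∧-comm x y) (dot-comm u v)

dot-⊥ˡ : ∀ {n} (v : Vector n) → dot ⊥ v ≡ false
dot-⊥ˡ []      = refl
dot-⊥ˡ (x ∷ v) = dot-⊥ˡ v

dot-⊥ʳ : ∀ {n} (v : Vector n) → dot v ⊥ ≡ false
dot-⊥ʳ v = trans (dot-comm v ⊥) (dot-⊥ˡ v)

dot-unit : ∀ {n} (i : Fin n) (v : Vector n) → dot ⁅ i ⁆ v ≡ lookup v i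
dot-unit zero    (x ∷ v) = trans (cong ((true ∧ x) xor_) (dot-⊥ˡ v)) (BP.xor-identityʳ x)
dot-unit (suc i) (x ∷ v) = dot-unit i v

record Linear {n} (f : Vector n → Vector n) : Set where
  constructor linear
  field additive : ∀ u w i → lookup (f (u △ w)) i ≡ lookup (f u) i xor lookup (f w) i
open Linear public

-- Self-adjoint maps are exactly those given by symmetric matrices.
record SelfAdjoint {n} (f : Vector n → Vector n) : Set where
  constructor selfAdjoint
  field adjoint : ∀ u w → dot u (f w) ≡ dot w (f u)
open SelfAdjoint public

IsZero : ∀ {n} → Vector n → Set
IsZero x = ∀ i → lookup x i ≡ false

NonZero : ∀ {n} → Vector n → Set
NonZero x = ∃ λ i → lookup x i ≡ true

IsZero⇒≡⊥ : ∀ {n} {x : Vector n} → IsZero x → x ≡ ⊥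
IsZero⇒≡⊥ z = ≐⇒≡ λ i → trans (z i) (sym (lookup-⊥ i))

linear-⊥ : ∀ {n} {f : Vector n → Vector n} → Linear f → IsZero (f ⊥)
linear-⊥ {f = f} lin i =
  trans (cong (λ z → lookup (f z) i) (sym (△-self ⊥))) (trans (additive lin ⊥ ⊥ i) (BP.xor-same (lookup (f ⊥) i)))

linear-zero : ∀ {n} {f : Vector n → Vector n} → Linear f → ∀ {x} → IsZero x → IsZero (f x)
linear-zero {f = f} lin z i = trans (cong (λ y → lookup (f y) i) (IsZero⇒≡⊥ z)) (linear-⊥ lin i)

linear-scale : ∀ {n} {f : Vector n → Vector n} → Linear f →
  ∀ c x i → lookup (f (scale c x)) i ≡ c ∧ lookup (f x) i
linear-scale lin true  x i = refl
linear-scale lin false x i = linear-⊥ lin i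

linear-△ : ∀ {n} {f : Vector n → Vector n} → Linear f → ∀ u w → f (u △ w) ≡ f u △ f w
linear-△ {f = f} lin u w = ≐⇒≡ λ i → trans (additive lin u w i) (sym (lookup-△ (f u) (f w) i))

entry : ∀ {n} → (Vector n → Vector n) → Fin n → Fin n → Bool
entry f p q = lookup (f ⁅ q ⁆) p

entry-sym : ∀ {n} {f : Vector n → Vector n} → SelfAdjoint f → ∀ p q → entry f p q ≡ entry f q p
entry-sym {f = f} sa p q = trans (sym (dot-unit p (f ⁅ q ⁆))) (trans (adjoint sa ⁅ p ⁆ ⁅ q ⁆) (dot-unit q (f ⁅ p ⁆)))

SupportedIn : ∀ {n} → Vector n → Vector n → Set
SupportedIn x Z = ∀ i → lookup x i ≡ true → lookup Z i ≡ true

VanishesOn : ∀ {n} → Vector n → Vector n → Set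
VanishesOn y Z = ∀ i → lookup Z i ≡ true → lookup y i ≡ false

-- f is nonsingular on Z: the principal submatrix f[Z] has trivial kernel.
NonsingularOn : ∀ {n} → (Vector n → Vector n) → Vector n → Set
NonsingularOn f Z = ∀ x → SupportedIn x Z → VanishesOn (f x) Z → IsZero x

SingularOn : ∀ {n} → (Vector n → Vector n) → Vector n → Set
SingularOn f Z = Σ _ λ x → SupportedIn x Z × VanishesOn (f x) Z × NonZero x

singular⇒¬nonsingular : ∀ {n} {f : Vector n → Vector n} {Z} → SingularOn f Z → ¬ NonsingularOn f Z
singular⇒¬nonsingular (x , s , v , i , xi) ns = true≢false (trans (sym xi) (ns x s v i))

nonsingular-or-singular : ∀ {n} (f : Vector n → Vector n) Z → NonsingularOn f Z ⊎ SingularOn f Z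
nonsingular-or-singular f Z with anySubset? (λ x → supported? x ×-dec vanishes? (f x) ×-dec nonzero? x)
  where
  supported? : ∀ x → Dec (SupportedIn x Z)
  supported? x = FinP.all? λ i → (lookup x i B.≟ true) →-dec (lookup Z i B.≟ true)
  vanishes? : ∀ y → Dec (VanishesOn y Z)
  vanishes? y = FinP.all? λ i → (lookup Z i B.≟ true) →-dec (lookup y i B.≟ false)
  nonzero? : ∀ x → Dec (NonZero x)
  nonzero? x = FinP.any? λ i → lookup x i B.≟ true
... | yes (x , s , v , nz) = inj₂ (x , s , v , nz)
... | no none              = inj₁ λ x s v i → BP.¬-not λ xi → none (x , s , v , i , xi)

nonsingular? : ∀ {n} (f : Vector n → Vector n) Z → Dec (NonsingularOn f Z)
nonsingular? f Z with nonsingular-or-singular f Z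
... | inj₁ ns = yes ns
... | inj₂ s  = no (singular⇒¬nonsingular {f = f} {Z} s)

D : ∀ {n} → (Vector n → Vector n) → Family n
D f Z = does (nonsingular? f Z)

D-true : ∀ {n} {f : Vector n → Vector n} {Z} → NonsingularOn f Z → D f Z ≡ true
D-true {f = f} {Z} ns with nonsingular? f Z
... | yes _   = refl
... | no  ¬ns = absurd (¬ns ns)

D-false : ∀ {n} {f : Vector n → Vector n} {Z} → SingularOn f Z → D f Z ≡ false
D-false {f = f} {Z} s with nonsingular? f Z
... | yes ns = absurd (singular⇒¬nonsingular {f = f} {Z} s ns)
... | no  _  = refl

D-true⁻¹ : ∀ {n} {f : Vector n → Vector n} {Z} → D f Z ≡ true → NonsingularOn f Z
D-true⁻¹ {f = f} {Z} e with nonsingular? f Z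
... | yes ns = ns

D-cong : ∀ {n} {f g : Vector n → Vector n} {Y Z} →
  (NonsingularOn f Y → NonsingularOn g Z) → (NonsingularOn g Z → NonsingularOn f Y) → D f Y ≡ D g Z
D-cong {f = f} {g} {Y} {Z} to from with nonsingular? f Y | nonsingular? g Z
... | yes _   | yes _   = refl
... | no  _   | no  _   = refl
... | yes nsf | no ¬nsg = absurd (¬nsg (to nsf))
... | no ¬nsf | yes nsg = absurd (¬nsf (from nsg))

Represents : ∀ {n} → (Vector n → Vector n) → Family n → Set
Represents f F = ∀ X → F X ≡ D f X

select-select : ∀ {n} (S T u v : Vector n) → select S (select T u v) (select T v u) ≡ select (S △ T) u v
select-select S T u v = ≐⇒≡ λ i → begin
  lookup (select S (select T u v) (select T v u)) i
    ≡⟨ lookup-select S (select T u v) (select T v u) i ⟩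
  (if lookup S i then lookup (select T v u) i else lookup (select T u v) i)
    ≡⟨ cong₂ (if lookup S i then_else_) (lookup-select T v u i) (lookup-select T u v i) ⟩
  (if lookup S i then (if lookup T i then lookup u i else lookup v i)
                 else (if lookup T i then lookup v i else lookup u i))
    ≡⟨ nested (lookup S i) (lookup T i) (lookup u i) (lookup v i) ⟩
  (if lookup S i xor lookup T i then lookup v i else lookup u i)
    ≡⟨ cong (if_then lookup v i else lookup u i) (sym (lookup-△ S T i)) ⟩
  (if lookup (S △ T) i then lookup v i else lookup u i)
    ≡⟨ sym (lookup-select (S △ T) u v i) ⟩
  lookup (select (S △ T) u v) i ∎
  where
  open ≡-Reasoning
  nested : ∀ s t x y → (if s then (if t then x else y) else (if t then y else x)) ≡ (if s xor t then y else x)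
  nested = byTruthTable 4

select-⊥ : ∀ {n} (u v : Vector n) → select ⊥ u v ≡ u
select-⊥ u v = ≐⇒≡ λ i → trans (lookup-select ⊥ u v i) (cong (if_then lookup v i else lookup u i) (lookup-⊥ i))

select-involutive : ∀ {n} (S u v : Vector n) → select S (select S u v) (select S v u) ≡ u
select-involutive S u v = trans (select-select S S u v) (trans (cong (λ T → select T u v) (△-self S)) (select-⊥ u v))

select-△ : ∀ {n} (S u v u′ v′ : Vector n) → select S (u △ u′) (v △ v′) ≡ select S u v △ select S u′ v′
select-△ S u v u′ v′ = ≐⇒≡ λ i → begin
  lookup (select S (u △ u′) (v △ v′)) i
    ≡⟨ lookup-select S (u △ u′) (v △ v′) i ⟩
  (if lookup S i then lookup (v △ v′) i else lookup (u △ u′) i)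
    ≡⟨ cong₂ (if lookup S i then_else_) (lookup-△ v v′ i) (lookup-△ u u′ i) ⟩
  (if lookup S i then lookup v i xor lookup v′ i else lookup u i xor lookup u′ i)
    ≡⟨ distrib (lookup S i) (lookup u i) (lookup v i) (lookup u′ i) (lookup v′ i) ⟩
  (if lookup S i then lookup v i else lookup u i) xor (if lookup S i then lookup v′ i else lookup u′ i)
    ≡⟨ sym (cong₂ _xor_ (lookup-select S u v i) (lookup-select S u′ v′ i)) ⟩
  lookup (select S u v) i xor lookup (select S u′ v′) i
    ≡⟨ sym (lookup-△ (select S u v) (select S u′ v′) i) ⟩
  lookup (select S u v △ select S u′ v′) i ∎
  where
  open ≡-Reasoning
  distrib : ∀ s x y x′ y′ → (if s then y xor y′ else x xor x′) ≡ (if s then y else x) xor (if s then y′ else x′)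
  distrib = byTruthTable 5

select-zero : ∀ {n} (S u v : Vector n) → IsZero (select S u v) → IsZero (select S v u) → IsZero u
select-zero S u v z z′ i with lookup S i in Si
... | true  = trans (sym (trans (lookup-select S v u i) (cong (if_then lookup u i else lookup v i) Si))) (z′ i)
... | false = trans (sym (trans (lookup-select S u v i) (cong (if_then lookup v i else lookup u i) Si))) (z i)

-- The symplectic identity behind the symmetry of pivots: exchanging coordinates
-- preserves the form (u, v), (w, y) ↦ ⟨u, y⟩ + ⟨w, v⟩ on pairs of vectors.
select-symplectic : ∀ {n} (S u v w y : Vector n) →
  dot (select S u v) (select S y w) xor dot (select S w y) (select S v u) ≡ dot u y xor dot w v
select-symplectic []      []      []      []      []      = refl
select-symplectic (s ∷ S) (x ∷ u) (p ∷ v) (z ∷ w) (q ∷ y) =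
  begin
    ((sel s x p ∧ sel s q z) xor dot (select S u v) (select S y w)) xor
      ((sel s z q ∧ sel s p x) xor dot (select S w y) (select S v u))
  ≡⟨ step s x p z q _ _ ⟩
    ((x ∧ q) xor (z ∧ p)) xor (dot (select S u v) (select S y w) xor dot (select S w y) (select S v u))
  ≡⟨ cong (((x ∧ q) xor (z ∧ p)) xor_) (select-symplectic S u v w y) ⟩
    ((x ∧ q) xor (z ∧ p)) xor (dot u y xor dot w v)
  ≡⟨ xor-interchange (x ∧ q) (z ∧ p) (dot u y) (dot w v) ⟩
    ((x ∧ q) xor dot u y) xor ((z ∧ p) xor dot w v)
  ∎
  where
  open ≡-Reasoning
  sel : Bool → Bool → Bool → Bool
  sel s a b = if s then b else a
  step : ∀ s x p z q d e → ((sel s x p ∧ sel s q z) xor d) xor ((sel s z q ∧ sel s p x) xor e) ≡ ((x ∧ q) xor (z ∧ p)) xor (d xor e)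
  step = byTruthTable 7

KernelPair : ∀ {n} → Vector n → Vector n → Vector n → Set
KernelPair x y Z = SupportedIn x Z × VanishesOn y Z

kernelBit : Bool → Bool → Bool → Bool
kernelBit x y z = (not x ∨ z) ∧ (not z ∨ not y)

kernelPair⇒bits : ∀ {n} {x y Z : Vector n} → KernelPair x y Z → ∀ i → kernelBit (lookup x i) (lookup y i) (lookup Z i) ≡ true
kernelPair⇒bits {x = x} {y} {Z} (s , v) i = bit (lookup x i) (lookup y i) (lookup Z i) (s i) (v i)
  where
  bit : ∀ a b c → (a ≡ true → c ≡ true) → (c ≡ true → b ≡ false) → kernelBit a b c ≡ true
  bit false b     false _ _ = refl
  bit false false true  _ _ = refl
  bit false true  true  _ h = sym (h refl)
  bit true  b     false h _ = h refl
  bit true  false true  _ _ = refl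
  bit true  true  true  _ h = sym (h refl)

bits⇒kernelPair : ∀ {n} {x y Z : Vector n} → (∀ i → kernelBit (lookup x i) (lookup y i) (lookup Z i) ≡ true) → KernelPair x y Z
bits⇒kernelPair {x = x} {y} {Z} k = (λ i → supp (lookup x i) (lookup y i) (lookup Z i) (k i))
                                 , (λ i → vanish (lookup x i) (lookup y i) (lookup Z i) (k i))
  where
  supp : ∀ a b c → kernelBit a b c ≡ true → a ≡ true → c ≡ true
  supp true b true _ _ = refl
  vanish : ∀ a b c → kernelBit a b c ≡ true → c ≡ true → b ≡ false
  vanish a false true _ _ = refl
  vanish false true true () _
  vanish true  true true () _

kernel-exchange : ∀ {n} (S x y Z : Vector n) → KernelPair x y (S △ Z) → KernelPair (select S x y) (select S y x) Z
kernel-exchange S x y Z k = bits⇒kernelPair {x = select S x y} {select S y x} {Z} λ i → begin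
  kernelBit (lookup (select S x y) i) (lookup (select S y x) i) (lookup Z i)
    ≡⟨ cong₂ (λ a b → kernelBit a b (lookup Z i)) (lookup-select S x y i) (lookup-select S y x i) ⟩
  kernelBit (if lookup S i then lookup y i else lookup x i) (if lookup S i then lookup x i else lookup y i) (lookup Z i)
    ≡⟨ exchangeBit (lookup S i) (lookup x i) (lookup y i) (lookup Z i) ⟩
  kernelBit (lookup x i) (lookup y i) (lookup S i xor lookup Z i)
    ≡⟨ cong (kernelBit (lookup x i) (lookup y i)) (sym (lookup-△ S Z i)) ⟩
  kernelBit (lookup x i) (lookup y i) (lookup (S △ Z) i)
    ≡⟨ kernelPair⇒bits {x = x} {y} {S △ Z} k i ⟩
  true ∎
  where
  open ≡-Reasoning
  exchangeBit : ∀ s x y z → kernelBit (if s then y else x) (if s then x else y) z ≡ kernelBit x y (s xor z)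
  exchangeBit = byTruthTable 4

-- g is the principal pivot transform of f on S: the graph of g arises from the
-- graph of f by exchanging the coordinates in S between argument and value.
record PivotOf {n} (f : Vector n → Vector n) (S : Vector n) (g : Vector n → Vector n) : Set where
  constructor pivotOf
  field
    forward  : ∀ u v → g u ≡ v → f (select S u v) ≡ select S v u
    backward : ∀ u v → f (select S u v) ≡ select S v u → g u ≡ v

  graph : ∀ u → f (select S u (g u)) ≡ select S (g u) u
  graph u = forward u (g u) refl
open PivotOf public

pivot-⊥ : ∀ {n} (f : Vector n → Vector n) → PivotOf f ⊥ f
pivot-⊥ f = pivotOf (λ u v e → trans (cong f (select-⊥ u v)) (trans e (sym (select-⊥ v u))))
                    (λ u v e → trans (cong f (sym (select-⊥ u v))) (trans e (select-⊥ v u)))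

pivot-∘ : ∀ {n} {f g h : Vector n → Vector n} {S T} → PivotOf f S g → PivotOf g T h → PivotOf f (S △ T) h
pivot-∘ {f = f} {S = S} {T} p q = pivotOf
  (λ u v e → subst₂ graphOf (select-select S T u v) (select-select S T v u)
                    (forward p (select T u v) (select T v u) (forward q u v e)))
  (λ u v e → backward q u v (backward p (select T u v) (select T v u)
                    (subst₂ graphOf (sym (select-select S T u v)) (sym (select-select S T v u)) e)))
  where
  graphOf : Vector _ → Vector _ → Set
  graphOf a b = f a ≡ b

pivot-linear : ∀ {n} {f g : Vector n → Vector n} {S} → Linear f → PivotOf f S g → Linear g
pivot-linear {f = f} {g} {S} lin p = linear λ u w i → trans (cong (λ z → lookup z i) (additive-graph u w)) (lookup-△ (g u) (g w) i)
  where
  additive-graph : ∀ u w → g (u △ w) ≡ g u △ g w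
  additive-graph u w = backward p (u △ w) (g u △ g w) (begin
    f (select S (u △ w) (g u △ g w))                ≡⟨ cong f (select-△ S u (g u) w (g w)) ⟩
    f (select S u (g u) △ select S w (g w))         ≡⟨ linear-△ lin (select S u (g u)) (select S w (g w)) ⟩
    f (select S u (g u)) △ f (select S w (g w))     ≡⟨ cong₂ _△_ (graph p u) (graph p w) ⟩
    select S (g u) u △ select S (g w) w             ≡⟨ sym (select-△ S (g u) u (g w) w) ⟩
    select S (g u △ g w) (u △ w)                    ∎)
    where open ≡-Reasoning

xor≡false⇒≡ : ∀ {a b} → a xor b ≡ false → a ≡ b
xor≡false⇒≡ {false} {false} _ = refl
xor≡false⇒≡ {true}  {true}  _ = refl

pivot-selfAdjoint : ∀ {n} {f g : Vector n → Vector n} {S} → SelfAdjoint f → PivotOf f S g → SelfAdjoint g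
pivot-selfAdjoint {f = f} {g} {S} sa p = selfAdjoint λ u w → xor≡false⇒≡ (begin
  dot u (g w) xor dot w (g u)
    ≡⟨ sym (select-symplectic S u (g u) w (g w)) ⟩
  dot (select S u (g u)) (select S (g w) w) xor dot (select S w (g w)) (select S (g u) u)
    ≡⟨ cong₂ (λ a b → dot (select S u (g u)) a xor dot (select S w (g w)) b) (sym (graph p w)) (sym (graph p u)) ⟩
  dot (select S u (g u)) (f (select S w (g w))) xor dot (select S w (g w)) (f (select S u (g u)))
    ≡⟨ cong (_xor dot (select S w (g w)) (f (select S u (g u)))) (adjoint sa (select S u (g u)) (select S w (g w))) ⟩
  dot (select S w (g w)) (f (select S u (g u))) xor dot (select S w (g w)) (f (select S u (g u)))
    ≡⟨ BP.xor-same (dot (select S w (g w)) (f (select S u (g u)))) ⟩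
  false ∎)
  where open ≡-Reasoning

-- The pivot on S is nonsingular on Y exactly when f is nonsingular on S △ Y;
-- in set-system terms, D(g) = D(f) * S.
pivot-nonsingular : ∀ {n} {f g : Vector n → Vector n} {S} → Linear g → PivotOf f S g →
  ∀ Y → NonsingularOn g Y → NonsingularOn f (S △ Y)
pivot-nonsingular {f = f} {g} {S} lin-g p Y ns x sx vx = select-zero S x (f x) u-zero v-zero
  where
  u = select S x (f x)
  v = select S (f x) x
  gu≡v : g u ≡ v
  gu≡v = backward p u v (trans (cong f (select-involutive S x (f x))) (sym (select-involutive S (f x) x)))
  kernel : KernelPair u v Y
  kernel = kernel-exchange S x (f x) Y (sx , vx)
  u-zero : IsZero u
  u-zero = ns u (proj₁ kernel) (subst (λ z → VanishesOn z Y) (sym gu≡v) (proj₂ kernel))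
  v-zero : IsZero v
  v-zero = subst IsZero gu≡v (linear-zero lin-g u-zero)

pivot-nonsingular⁻¹ : ∀ {n} {f g : Vector n → Vector n} {S} → Linear f → PivotOf f S g →
  ∀ Y → NonsingularOn f (S △ Y) → NonsingularOn g Y
pivot-nonsingular⁻¹ {f = f} {g} {S} lin-f p Y ns x sx vx = select-zero S x (g x) u-zero v-zero
  where
  u = select S x (g x)
  kernel : KernelPair u (select S (g x) x) (S △ Y)
  kernel = kernel-exchange S x (g x) (S △ Y) (subst (KernelPair x (g x)) (sym (△-cancelˡ S Y)) (sx , vx))
  u-zero : IsZero u
  u-zero = ns u (proj₁ kernel) (subst (λ z → VanishesOn z (S △ Y)) (sym (graph p x)) (proj₂ kernel))
  v-zero : IsZero (select S (g x) x)
  v-zero = subst IsZero (graph p x) (linear-zero lin-f u-zero)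

select-⊥-supported : ∀ {n} (S d : Vector n) → SupportedIn (select S ⊥ d) S
select-⊥-supported S d i e with lookup S i in Si
... | true  = refl
... | false = absurd (true≢false (trans (sym e) (trans (lookup-select S ⊥ d i) (trans (cong (if_then lookup d i else lookup ⊥ i) Si) (lookup-⊥ i)))))

select-⊥-vanishes : ∀ {n} (S d : Vector n) → VanishesOn (select S d ⊥) S
select-⊥-vanishes S d i Si = trans (lookup-select S d ⊥ i) (trans (cong (if_then lookup ⊥ i else lookup d i) Si) (lookup-⊥ i))

-- Solutions of the exchanged graph equation are unique when f is nonsingular on S,
-- so any solution map is the pivot.
solution⇒pivot : ∀ {n} {f : Vector n → Vector n} {S} → Linear f → NonsingularOn f S →
  (g : Vector n → Vector n) → (∀ u → f (select S u (g u)) ≡ select S (g u) u) → PivotOf f S g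
solution⇒pivot {f = f} {S} lin ns g solves = pivotOf (λ { u v refl → solves u }) unique
  where
  unique : ∀ u v → f (select S u v) ≡ select S v u → g u ≡ v
  unique u v e = ≐⇒≡ λ i → xor≡false⇒≡ (trans (sym (lookup-△ (g u) v i)) (d-zero i))
    where
    d = g u △ v
    x≡ : select S u (g u) △ select S u v ≡ select S ⊥ d
    x≡ = trans (sym (select-△ S u (g u) u v)) (cong (λ z → select S z d) (△-self u))
    fx≡ : f (select S ⊥ d) ≡ select S d ⊥
    fx≡ = begin
      f (select S ⊥ d)                              ≡⟨ cong f (sym x≡) ⟩
      f (select S u (g u) △ select S u v)           ≡⟨ linear-△ lin (select S u (g u)) (select S u v) ⟩
      f (select S u (g u)) △ f (select S u v)       ≡⟨ cong₂ _△_ (solves u) e ⟩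
      select S (g u) u △ select S v u               ≡⟨ sym (select-△ S (g u) u v u) ⟩
      select S d (u △ u)                            ≡⟨ cong (select S d) (△-self u) ⟩
      select S d ⊥                                  ∎
      where open ≡-Reasoning
    x-zero : IsZero (select S ⊥ d)
    x-zero = ns (select S ⊥ d) (select-⊥-supported S d) (subst (λ z → VanishesOn z S) (sym fx≡) (select-⊥-vanishes S d))
    d-zero : IsZero d
    d-zero = select-zero S d ⊥ (subst IsZero fx≡ (linear-zero lin x-zero)) x-zero

blockSolution : ∀ {n} → (Vector n → Vector n) → Vector n → (Vector n → Vector n) → Vector n → Vector n
blockSolution f S c u = select S (f (select S u ⊥) △ f (c u)) (c u)

blockSolution-solves : ∀ {n} {f : Vector n → Vector n} {S} → Linear f → (c : Vector n → Vector n) →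
  (∀ u → SupportedIn (c u) S) →
  (∀ u i → lookup S i ≡ true → lookup (f (select S u ⊥) △ f (c u)) i ≡ lookup u i) →
  ∀ u → f (select S u (blockSolution f S c u)) ≡ select S (blockSolution f S c u) u
blockSolution-solves {f = f} {S} lin c supp agree u = begin
  f (select S u s)                     ≡⟨ cong f (≐⇒≡ argument) ⟩
  f (select S u ⊥ △ c u)               ≡⟨ linear-△ lin (select S u ⊥) (c u) ⟩
  r                                    ≡⟨ ≐⇒≡ value ⟩
  select S s u                         ∎
  where
  open ≡-Reasoning
  r = f (select S u ⊥) △ f (c u)
  s = blockSolution f S c u
  argument : select S u s ≐ select S u ⊥ △ c u
  argument i rewrite lookup-select S u s i | lookup-select S r (c u) i
                   | lookup-△ (select S u ⊥) (c u) i | lookup-select S u ⊥ i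
    with lookup S i in Si
  ... | true  = cong (_xor lookup (c u) i) (sym (lookup-⊥ i))
  ... | false = sym (trans (cong (lookup u i xor_) (BP.¬-not λ ci → true≢false (trans (sym (supp u i ci)) Si)))
                           (BP.xor-identityʳ (lookup u i)))
  value : r ≐ select S s u
  value i rewrite lookup-select S s u i | lookup-select S r (c u) i with lookup S i in Si
  ... | true  = agree u i Si
  ... | false = refl

lookup-pair : ∀ {n} {a b : Fin n} c d i →
  lookup (scale c ⁅ a ⁆ △ scale d ⁅ b ⁆) i ≡ (c ∧ lookup ⁅ a ⁆ i) xor (d ∧ lookup ⁅ b ⁆ i)
lookup-pair {a = a} {b} c d i =
  trans (lookup-△ (scale c ⁅ a ⁆) (scale d ⁅ b ⁆) i) (cong₂ _xor_ (lookup-scale c ⁅ a ⁆ i) (lookup-scale d ⁅ b ⁆ i))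

supported-unit : ∀ {n} (a : Fin n) x → SupportedIn x ⁅ a ⁆ → x ≡ scale (lookup x a) ⁅ a ⁆
supported-unit a x s = ≐⇒≡ λ i → sym (trans (lookup-scale (lookup x a) ⁅ a ⁆ i) (at i))
  where
  at : ∀ i → lookup x a ∧ lookup ⁅ a ⁆ i ≡ lookup x i
  at i with a FinP.≟ i
  ... | yes refl = trans (cong (lookup x a ∧_) (lookup-unit-≡ a)) (BP.∧-identityʳ _)
  ... | no a≢i   = trans (cong (lookup x a ∧_) (lookup-unit-≢ a≢i))
                         (trans (BP.∧-zeroʳ _) (sym (BP.¬-not λ xi → true≢false (trans (sym (s i xi)) (lookup-unit-≢ a≢i)))))

supported-pair : ∀ {n} {a b : Fin n} → a ≢ b → ∀ x → SupportedIn x (⁅ a ⁆ △ ⁅ b ⁆) →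
  x ≡ scale (lookup x a) ⁅ a ⁆ △ scale (lookup x b) ⁅ b ⁆
supported-pair {a = a} {b} a≢b x s = ≐⇒≡ λ i → sym (trans (lookup-pair (lookup x a) (lookup x b) i) (at i))
  where
  at : ∀ i → (lookup x a ∧ lookup ⁅ a ⁆ i) xor (lookup x b ∧ lookup ⁅ b ⁆ i) ≡ lookup x i
  at i with a FinP.≟ i | b FinP.≟ i
  ... | yes refl | yes refl = absurd (a≢b refl)
  ... | yes refl | no b≢i   rewrite lookup-unit-≡ a | lookup-unit-≢ b≢i | BP.∧-zeroʳ (lookup x b) =
    trans (BP.xor-identityʳ _) (BP.∧-identityʳ _)
  ... | no a≢i   | yes refl rewrite lookup-unit-≡ b | lookup-unit-≢ a≢i | BP.∧-zeroʳ (lookup x a) = BP.∧-identityʳ _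
  ... | no a≢i   | no b≢i   rewrite lookup-unit-≢ a≢i | lookup-unit-≢ b≢i | BP.∧-zeroʳ (lookup x a) | BP.∧-zeroʳ (lookup x b) =
    sym (BP.¬-not λ xi → true≢false (trans (sym (s i xi)) (trans (lookup-△ ⁅ a ⁆ ⁅ b ⁆ i)
      (cong₂ _xor_ (lookup-unit-≢ a≢i) (lookup-unit-≢ b≢i)))))

∧≡true⇒ˡ : ∀ {a b} → a ∧ b ≡ true → a ≡ true
∧≡true⇒ˡ {true} e = refl

∧≡true⇒ʳ : ∀ {a b} → a ∧ b ≡ true → b ≡ true
∧≡true⇒ʳ {true} e = e

unit-member : ∀ {n} {a i : Fin n} → lookup ⁅ a ⁆ i ≡ true → a ≡ i
unit-member {a = a} {i} e with a FinP.≟ i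
... | yes a≡i = a≡i
... | no  a≢i = absurd (true≢false (trans (sym e) (lookup-unit-≢ a≢i)))

lookup-pair-left : ∀ {n} {a b : Fin n} → a ≢ b → lookup (⁅ a ⁆ △ ⁅ b ⁆) a ≡ true
lookup-pair-left {a = a} {b} a≢b = trans (lookup-△ ⁅ a ⁆ ⁅ b ⁆ a) (cong₂ _xor_ (lookup-unit-≡ a) (lookup-unit-≢ (a≢b ∘ sym)))

lookup-pair-right : ∀ {n} {a b : Fin n} → a ≢ b → lookup (⁅ a ⁆ △ ⁅ b ⁆) b ≡ true
lookup-pair-right {a = a} {b} a≢b = trans (lookup-△ ⁅ a ⁆ ⁅ b ⁆ b) (cong₂ _xor_ (lookup-unit-≢ a≢b) (lookup-unit-≡ b))

pair-member : ∀ {n} {a b i : Fin n} → lookup (⁅ a ⁆ △ ⁅ b ⁆) i ≡ true → a ≡ i ⊎ b ≡ i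
pair-member {a = a} {b} {i} e with a FinP.≟ i | b FinP.≟ i
... | yes a≡i | _       = inj₁ a≡i
... | no  _   | yes b≡i = inj₂ b≡i
... | no  a≢i | no  b≢i = absurd (true≢false (trans (sym e)
                            (trans (lookup-△ ⁅ a ⁆ ⁅ b ⁆ i) (cong₂ _xor_ (lookup-unit-≢ a≢i) (lookup-unit-≢ b≢i)))))

pair-supported : ∀ {n} {a b : Fin n} → a ≢ b → ∀ c d → SupportedIn (scale c ⁅ a ⁆ △ scale d ⁅ b ⁆) (⁅ a ⁆ △ ⁅ b ⁆)
pair-supported {a = a} {b} a≢b c d i e = trans (lookup-△ ⁅ a ⁆ ⁅ b ⁆ i) (side (a FinP.≟ i) (b FinP.≟ i) (trans (sym (lookup-pair c d i)) e))
  where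
  side : Dec (a ≡ i) → Dec (b ≡ i) → (c ∧ lookup ⁅ a ⁆ i) xor (d ∧ lookup ⁅ b ⁆ i) ≡ true → lookup ⁅ a ⁆ i xor lookup ⁅ b ⁆ i ≡ true
  side (yes refl) (yes refl) _ = absurd (a≢b refl)
  side (yes refl) (no b≢i)   _ rewrite lookup-unit-≡ a | lookup-unit-≢ b≢i = refl
  side (no a≢i)   (yes refl) _ rewrite lookup-unit-≢ a≢i | lookup-unit-≡ b = refl
  side (no a≢i)   (no b≢i)   e rewrite lookup-unit-≢ a≢i | lookup-unit-≢ b≢i | BP.∧-zeroʳ c | BP.∧-zeroʳ d = e

lookup-f-pair : ∀ {n} {f : Vector n → Vector n} → Linear f → ∀ {a b} c d i →
  lookup (f (scale c ⁅ a ⁆ △ scale d ⁅ b ⁆)) i ≡ (c ∧ entry f i a) xor (d ∧ entry f i b)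
lookup-f-pair {f = f} lin {a} {b} c d i =
  trans (additive lin (scale c ⁅ a ⁆) (scale d ⁅ b ⁆) i) (cong₂ _xor_ (linear-scale lin c ⁅ a ⁆ i) (linear-scale lin d ⁅ b ⁆ i))

module SinglePivot {n} {f : Vector n → Vector n} (lin : Linear f) (a : Fin n) (faa : entry f a a ≡ true) where

  correction : Vector n → Vector n
  correction u = scale (lookup u a xor lookup (f (select ⁅ a ⁆ u ⊥)) a) ⁅ a ⁆

  nonsingular : NonsingularOn f ⁅ a ⁆
  nonsingular x s v i = trans (cong (λ y → lookup y i) (supported-unit a x s))
                              (trans (cong (λ c → lookup (scale c ⁅ a ⁆) i) xa≡false) (lookup-⊥ i))
    where
    xa≡false : lookup x a ≡ false
    xa≡false = begin
      lookup x a                               ≡⟨ sym (BP.∧-identityʳ _) ⟩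
      lookup x a ∧ true                        ≡⟨ cong (lookup x a ∧_) (sym faa) ⟩
      lookup x a ∧ entry f a a                 ≡⟨ sym (linear-scale lin (lookup x a) ⁅ a ⁆ a) ⟩
      lookup (f (scale (lookup x a) ⁅ a ⁆)) a  ≡⟨ cong (λ y → lookup (f y) a) (sym (supported-unit a x s)) ⟩
      lookup (f x) a                           ≡⟨ v a (lookup-unit-≡ a) ⟩
      false                                    ∎
      where open ≡-Reasoning

  pivot : PivotOf f ⁅ a ⁆ (blockSolution f ⁅ a ⁆ correction)
  pivot = solution⇒pivot lin nonsingular _ (blockSolution-solves lin correction supported agrees)
    where
    supported : ∀ u → SupportedIn (correction u) ⁅ a ⁆
    supported u i e = ∧≡true⇒ʳ (trans (sym (lookup-scale (lookup u a xor lookup (f (select ⁅ a ⁆ u ⊥)) a) ⁅ a ⁆ i)) e)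
    agrees : ∀ u i → lookup ⁅ a ⁆ i ≡ true →
      lookup (f (select ⁅ a ⁆ u ⊥) △ f (correction u)) i ≡ lookup u i
    agrees u i e with unit-member {a = a} {i} e
    ... | refl = begin
      lookup (f (select ⁅ a ⁆ u ⊥) △ f (correction u)) a   ≡⟨ lookup-△ (f (select ⁅ a ⁆ u ⊥)) (f (correction u)) a ⟩
      w xor lookup (f (correction u)) a                     ≡⟨ cong (w xor_) (linear-scale lin (lookup u a xor w) ⁅ a ⁆ a) ⟩
      w xor ((lookup u a xor w) ∧ entry f a a)              ≡⟨ cong (λ d → w xor ((lookup u a xor w) ∧ d)) faa ⟩
      w xor ((lookup u a xor w) ∧ true)                     ≡⟨ cancel (lookup u a) w ⟩
      lookup u a                                            ∎
      where
      open ≡-Reasoning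
      w = lookup (f (select ⁅ a ⁆ u ⊥)) a
      cancel : ∀ x w → w xor ((x xor w) ∧ true) ≡ x
      cancel = byTruthTable 2

module PairPivot {n} {f : Vector n → Vector n} (lin : Linear f) {a b : Fin n} (a≢b : a ≢ b)
                 (faa : entry f a a ≡ false) (fbb : entry f b b ≡ false)
                 (fab : entry f a b ≡ true) (fba : entry f b a ≡ true) where

  S : Vector n
  S = ⁅ a ⁆ △ ⁅ b ⁆

  swapped : ∀ c d → lookup (f (scale c ⁅ a ⁆ △ scale d ⁅ b ⁆)) a ≡ d × lookup (f (scale c ⁅ a ⁆ △ scale d ⁅ b ⁆)) b ≡ c
  swapped c d = trans (lookup-f-pair lin c d a) (trans (cong₂ (λ p q → (c ∧ p) xor (d ∧ q)) faa fab) (atA c d))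
              , trans (lookup-f-pair lin c d b) (trans (cong₂ (λ p q → (c ∧ p) xor (d ∧ q)) fba fbb) (atB c d))
    where
    atA : ∀ c d → (c ∧ false) xor (d ∧ true) ≡ d
    atA = byTruthTable 2
    atB : ∀ c d → (c ∧ true) xor (d ∧ false) ≡ c
    atB = byTruthTable 2

  nonsingular : NonsingularOn f S
  nonsingular x s v i = trans (cong (λ y → lookup y i) x≡) (trans (cong₂ (λ c d → lookup (scale c ⁅ a ⁆ △ scale d ⁅ b ⁆) i) xa xb)
                              (trans (lookup-△ ⊥ ⊥ i) (cong₂ _xor_ (lookup-⊥ i) (lookup-⊥ i))))
    where
    x≡ = supported-pair a≢b x s
    xa : lookup x a ≡ false
    xa = trans (sym (proj₂ (swapped (lookup x a) (lookup x b)))) (trans (cong (λ y → lookup (f y) b) (sym x≡)) (v b (lookup-pair-right a≢b)))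
    xb : lookup x b ≡ false
    xb = trans (sym (proj₁ (swapped (lookup x a) (lookup x b)))) (trans (cong (λ y → lookup (f y) a) (sym x≡)) (v a (lookup-pair-left a≢b)))

  rest : Vector n → Vector n
  rest u = f (select S u ⊥)

  newA newB : Vector n → Bool
  newA u = lookup u b xor lookup (rest u) b
  newB u = lookup u a xor lookup (rest u) a

  correction : Vector n → Vector n
  correction u = scale (newA u) ⁅ a ⁆ △ scale (newB u) ⁅ b ⁆

  pivot : PivotOf f S (blockSolution f S correction)
  pivot = solution⇒pivot lin nonsingular _ (blockSolution-solves lin correction supported agrees)
    where
    supported : ∀ u → SupportedIn (correction u) S
    supported u = pair-supported a≢b (newA u) (newB u)
    cancel : ∀ x w → w xor (x xor w) ≡ x
    cancel = byTruthTable 2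
    agrees : ∀ u i → lookup S i ≡ true → lookup (rest u △ f (correction u)) i ≡ lookup u i
    agrees u i e with pair-member {a = a} {b} {i} e
    ... | inj₁ refl = trans (lookup-△ (rest u) (f (correction u)) a)
                            (trans (cong (lookup (rest u) a xor_) (proj₁ (swapped (newA u) (newB u)))) (cancel (lookup u a) (lookup (rest u) a)))
    ... | inj₂ refl = trans (lookup-△ (rest u) (f (correction u)) b)
                            (trans (cong (lookup (rest u) b xor_) (proj₂ (swapped (newA u) (newB u)))) (cancel (lookup u b) (lookup (rest u) b)))

size-remove : ∀ {n} (S : Vector n) a → lookup S a ≡ true → suc ∣ ⁅ a ⁆ △ S ∣ ≡ ∣ S ∣
size-remove (true  ∷ S) zero    refl = cong (λ X → suc ∣ X ∣) (△-identityˡ S)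
size-remove (true  ∷ S) (suc a) e    = cong suc (size-remove S a e)
size-remove (false ∷ S) (suc a) e    = size-remove S a e

size-remove-pair : ∀ {n} (S : Vector n) {a b} → a ≢ b → lookup S a ≡ true → lookup S b ≡ true →
  suc (suc ∣ (⁅ a ⁆ △ ⁅ b ⁆) △ S ∣) ≡ ∣ S ∣
size-remove-pair S {a} {b} a≢b Sa Sb = begin
  suc (suc ∣ (⁅ a ⁆ △ ⁅ b ⁆) △ S ∣)   ≡⟨ cong (λ X → suc (suc ∣ X ∣)) (△-assoc ⁅ a ⁆ ⁅ b ⁆ S) ⟩
  suc (suc ∣ ⁅ a ⁆ △ (⁅ b ⁆ △ S) ∣)   ≡⟨ cong suc (size-remove (⁅ b ⁆ △ S) a a∈) ⟩
  suc ∣ ⁅ b ⁆ △ S ∣                   ≡⟨ size-remove S b Sb ⟩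
  ∣ S ∣                               ∎
  where
  open ≡-Reasoning
  a∈ : lookup (⁅ b ⁆ △ S) a ≡ true
  a∈ = trans (lookup-△ ⁅ b ⁆ S a) (cong₂ _xor_ (lookup-unit-≢ (a≢b ∘ sym)) Sa)

pivot-then : ∀ {n} {f g : Vector n → Vector n} {T} → Linear f → PivotOf f T g →
  ∀ S → (NonsingularOn g (T △ S) → Σ _ (PivotOf g (T △ S))) → NonsingularOn f S → Σ _ (PivotOf f S)
pivot-then {f = f} {T = T} lin p S continue ns
  with continue (pivot-nonsingular⁻¹ lin p (T △ S) (subst (NonsingularOn f) (sym (△-cancelˡ T S)) ns))
... | h , q = h , subst (λ Z → PivotOf f Z h) (△-cancelˡ T S) (pivot-∘ p q)

-- Every nonsingular principal submatrix of a self-adjoint map can be pivoted on,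
-- by successive pivots on a diagonal 1 or on a block (0 1; 1 0).  Induction on ∣ S ∣.
pivot-exists′ : ∀ k {n} {f : Vector n → Vector n} → Linear f → SelfAdjoint f →
  ∀ S → ∣ S ∣ ≤ k → NonsingularOn f S → Σ _ (PivotOf f S)
pivot-exists′ k {f = f} lin sa S size ns with FinP.any? (λ a → lookup S a B.≟ true)
... | no empty = f , subst (λ Z → PivotOf f Z f) (sym S≡⊥) (pivot-⊥ f)
  where
  S≡⊥ : S ≡ ⊥
  S≡⊥ = IsZero⇒≡⊥ λ i → BP.¬-not λ Si → empty (i , Si)
pivot-exists′ zero    lin sa S size ns | yes (a , Sa) with subst (_≤ zero) (sym (size-remove S a Sa)) size
... | ()
pivot-exists′ (suc k) {f = f} lin sa S size ns | yes (a , Sa) = byDiagonal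
  where
  single : ∀ c → lookup S c ≡ true → entry f c c ≡ true → Σ _ (PivotOf f S)
  single c Sc fcc = pivot-then lin p S (pivot-exists′ k (pivot-linear lin p) (pivot-selfAdjoint sa p) (⁅ c ⁆ △ S) smaller) ns
    where
    p = SinglePivot.pivot lin c fcc
    smaller = ℕP.≤-pred (subst (_≤ suc k) (sym (size-remove S c Sc)) size)

  pair : ∀ b → lookup S b ≡ true → entry f a a ≡ false → entry f b b ≡ false → entry f b a ≡ true → Σ _ (PivotOf f S)
  pair b Sb faa fbb fba = pivot-then lin p S (pivot-exists′ k (pivot-linear lin p) (pivot-selfAdjoint sa p) ((⁅ a ⁆ △ ⁅ b ⁆) △ S) smaller) ns
    where
    a≢b : a ≢ b
    a≢b refl = true≢false (trans (sym fba) faa)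
    p = PairPivot.pivot lin a≢b faa fbb (trans (entry-sym sa a b) fba) fba
    smaller = ℕP.<⇒≤ (ℕP.≤-pred (subst (_≤ suc k) (sym (size-remove-pair S a≢b Sa Sb)) size))

  -- some b ∈ S has entry f b a = 1, for otherwise ⁅ a ⁆ would be a kernel vector of f[S]
  partner : Σ _ λ b → lookup S b ≡ true × entry f b a ≡ true
  partner with FinP.any? (λ b → (lookup S b B.≟ true) ×-dec (entry f b a B.≟ true))
  ... | yes found = found
  ... | no  none  = absurd (true≢false (trans (sym (lookup-unit-≡ a)) (ns ⁅ a ⁆ supported vanishes a)))
    where
    supported : SupportedIn ⁅ a ⁆ S
    supported i e = subst (λ j → lookup S j ≡ true) (unit-member {a = a} {i} e) Sa
    vanishes : VanishesOn (f ⁅ a ⁆) S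
    vanishes i Si = BP.¬-not λ fia → none (i , Si , fia)

  byDiagonal : Σ _ (PivotOf f S)
  byDiagonal with entry f a a B.≟ true
  ... | yes faa = single a Sa faa
  ... | no  faa with partner
  ...   | b , Sb , fba with entry f b b B.≟ true
  ...     | yes fbb = single b Sb fbb
  ...     | no  fbb = pair b Sb (BP.¬-not faa) (BP.¬-not fbb) fba

pivot-exists : ∀ {n} {f : Vector n → Vector n} → Linear f → SelfAdjoint f →
  ∀ S → NonsingularOn f S → Σ _ (PivotOf f S)
pivot-exists {n} lin sa S = pivot-exists′ n lin sa S (∣p∣≤n S)

addTo : ∀ {n} → Fin n → Fin n → Vector n → Vector n
addTo p q v = v [ p ]≔ (lookup v p xor lookup v q)

lookup-addTo-≡ : ∀ {n} (p q : Fin n) v → lookup (addTo p q v) p ≡ lookup v p xor lookup v q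
lookup-addTo-≡ p q v = VecP.lookup∘update p v _

lookup-addTo-≢ : ∀ {n} {p i : Fin n} q v → p ≢ i → lookup (addTo p q v) i ≡ lookup v i
lookup-addTo-≢ {p = p} {i} q v p≢i = VecP.lookup∘update′ (p≢i ∘ sym) v _

addTo≡ : ∀ {n} (p q : Fin n) v → addTo p q v ≡ v △ scale (lookup v q) ⁅ p ⁆
addTo≡ p q v = ≐⇒≡ λ i → sym (trans (lookup-△ v (scale (lookup v q) ⁅ p ⁆) i) (trans (cong (lookup v i xor_) (lookup-scale (lookup v q) ⁅ p ⁆ i)) (at i)))
  where
  at : ∀ i → lookup v i xor (lookup v q ∧ lookup ⁅ p ⁆ i) ≡ lookup (addTo p q v) i
  at i with p FinP.≟ i
  ... | yes refl = trans (cong (λ e → lookup v p xor (lookup v q ∧ e)) (lookup-unit-≡ p))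
                         (trans (cong (lookup v p xor_) (BP.∧-identityʳ _)) (sym (lookup-addTo-≡ p q v)))
  ... | no  p≢i  = trans (cong (λ e → lookup v i xor (lookup v q ∧ e)) (lookup-unit-≢ p≢i))
                         (trans (cong (lookup v i xor_) (BP.∧-zeroʳ _)) (trans (BP.xor-identityʳ _) (sym (lookup-addTo-≢ q v p≢i))))

addTo-△ : ∀ {n} (p q : Fin n) u w → addTo p q (u △ w) ≡ addTo p q u △ addTo p q w
addTo-△ p q u w = begin
  addTo p q (u △ w)                                                ≡⟨ addTo≡ p q (u △ w) ⟩
  (u △ w) △ scale (lookup (u △ w) q) ⁅ p ⁆                         ≡⟨ cong (λ c → (u △ w) △ scale c ⁅ p ⁆) (lookup-△ u w q) ⟩
  (u △ w) △ scale (lookup u q xor lookup w q) ⁅ p ⁆                ≡⟨ ≐⇒≡ coordinate ⟩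
  (u △ scale (lookup u q) ⁅ p ⁆) △ (w △ scale (lookup w q) ⁅ p ⁆)  ≡⟨ sym (cong₂ _△_ (addTo≡ p q u) (addTo≡ p q w)) ⟩
  addTo p q u △ addTo p q w                                        ∎
  where
  open ≡-Reasoning
  regroup : ∀ x y c d e → (x xor y) xor ((c xor d) ∧ e) ≡ (x xor (c ∧ e)) xor (y xor (d ∧ e))
  regroup = byTruthTable 5
  coordinate : ∀ i → lookup ((u △ w) △ scale (lookup u q xor lookup w q) ⁅ p ⁆) i
                   ≡ lookup ((u △ scale (lookup u q) ⁅ p ⁆) △ (w △ scale (lookup w q) ⁅ p ⁆)) i
  coordinate i
    rewrite lookup-△ (u △ w) (scale (lookup u q xor lookup w q) ⁅ p ⁆) i | lookup-△ u w i
          | lookup-△ (u △ scale (lookup u q) ⁅ p ⁆) (w △ scale (lookup w q) ⁅ p ⁆) i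
          | lookup-△ u (scale (lookup u q) ⁅ p ⁆) i | lookup-△ w (scale (lookup w q) ⁅ p ⁆) i
          | lookup-scale (lookup u q xor lookup w q) ⁅ p ⁆ i | lookup-scale (lookup u q) ⁅ p ⁆ i
          | lookup-scale (lookup w q) ⁅ p ⁆ i
    = regroup (lookup u i) (lookup w i) (lookup u q) (lookup w q) (lookup ⁅ p ⁆ i)

dot-△ʳ : ∀ {n} (v u w : Vector n) → dot v (u △ w) ≡ dot v u xor dot v w
dot-△ʳ v u w = trans (dot-comm v (u △ w)) (trans (dot-△ˡ u w v) (cong₂ _xor_ (dot-comm u v) (dot-comm w v)))

dot-scale-unit : ∀ {n} (u : Vector n) c p → dot u (scale c ⁅ p ⁆) ≡ c ∧ lookup u p
dot-scale-unit u true  p = trans (dot-comm u ⁅ p ⁆) (dot-unit p u)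
dot-scale-unit u false p = dot-⊥ʳ u

dot-addTo : ∀ {n} (p q : Fin n) u y → dot u (addTo p q y) ≡ dot (addTo q p u) y
dot-addTo p q u y = begin
  dot u (addTo p q y)                                         ≡⟨ cong (dot u) (addTo≡ p q y) ⟩
  dot u (y △ scale (lookup y q) ⁅ p ⁆)                        ≡⟨ dot-△ʳ u y (scale (lookup y q) ⁅ p ⁆) ⟩
  dot u y xor dot u (scale (lookup y q) ⁅ p ⁆)                ≡⟨ cong (dot u y xor_) (dot-scale-unit u (lookup y q) p) ⟩
  dot u y xor (lookup y q ∧ lookup u p)                       ≡⟨ cong (dot u y xor_) (BP.∧-comm (lookup y q) (lookup u p)) ⟩
  dot u y xor (lookup u p ∧ lookup y q)                       ≡⟨ cong (dot u y xor_) (sym (dot-scale-unit y (lookup u p) q)) ⟩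
  dot u y xor dot y (scale (lookup u p) ⁅ q ⁆)                ≡⟨ cong (dot u y xor_) (dot-comm y (scale (lookup u p) ⁅ q ⁆)) ⟩
  dot u y xor dot (scale (lookup u p) ⁅ q ⁆) y                ≡⟨ sym (dot-△ˡ u (scale (lookup u p) ⁅ q ⁆) y) ⟩
  dot (u △ scale (lookup u p) ⁅ q ⁆) y                        ≡⟨ cong (λ z → dot z y) (sym (addTo≡ q p u)) ⟩
  dot (addTo q p u) y                                         ∎
  where open ≡-Reasoning

-- The handle slide of a over b acts on representing maps as the congruence
-- M ↦ E M Eᵀ by the transvection E adding row b to row a.
slideMap : ∀ {n} → Fin n → Fin n → (Vector n → Vector n) → Vector n → Vector n
slideMap a b f u = addTo a b (f (addTo b a u))

slideMap-linear : ∀ {n} {f : Vector n → Vector n} → Linear f → ∀ a b → Linear (slideMap a b f)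
slideMap-linear {f = f} lin a b = linear λ u w i → begin
  lookup (addTo a b (f (addTo b a (u △ w)))) i
    ≡⟨ cong (λ z → lookup (addTo a b (f z)) i) (addTo-△ b a u w) ⟩
  lookup (addTo a b (f (addTo b a u △ addTo b a w))) i
    ≡⟨ cong (λ z → lookup (addTo a b z) i) (linear-△ lin (addTo b a u) (addTo b a w)) ⟩
  lookup (addTo a b (f (addTo b a u) △ f (addTo b a w))) i
    ≡⟨ cong (λ z → lookup z i) (addTo-△ a b (f (addTo b a u)) (f (addTo b a w))) ⟩
  lookup (slideMap a b f u △ slideMap a b f w) i
    ≡⟨ lookup-△ (slideMap a b f u) (slideMap a b f w) i ⟩
  lookup (slideMap a b f u) i xor lookup (slideMap a b f w) i ∎
  where open ≡-Reasoning

slideMap-selfAdjoint : ∀ {n} {f : Vector n → Vector n} → SelfAdjoint f → ∀ a b → SelfAdjoint (slideMap a b f)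
slideMap-selfAdjoint {f = f} sa a b = selfAdjoint λ u w → begin
  dot u (addTo a b (f (addTo b a w)))     ≡⟨ dot-addTo a b u (f (addTo b a w)) ⟩
  dot (addTo b a u) (f (addTo b a w))     ≡⟨ adjoint sa (addTo b a u) (addTo b a w) ⟩
  dot (addTo b a w) (f (addTo b a u))     ≡⟨ sym (dot-addTo a b w (f (addTo b a u))) ⟩
  dot w (addTo a b (f (addTo b a u)))     ∎
  where open ≡-Reasoning

-- Lines through the origin of GF(2)⁴, as predicates on coordinates (x_a, x_b, y_a, y_b).
Line : Set
Line = Bool → Bool → Bool → Bool → Bool

line₁ line₂ line₃ : Line
line₁ xa xb ya yb = not xb ∧ not ya
line₂ xa xb ya yb = not xa ∧ not yb
line₃ xa xb ya yb = not (xa xor xb) ∧ not (ya xor yb)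

line₁-intro : ∀ {xa xb ya yb} → xb ≡ false → ya ≡ false → line₁ xa xb ya yb ≡ true
line₁-intro refl refl = refl

line₂-intro : ∀ {xa xb ya yb} → xa ≡ false → yb ≡ false → line₂ xa xb ya yb ≡ true
line₂-intro refl refl = refl

line₃-intro : ∀ {xa xb ya yb} → xa ≡ xb → ya ≡ yb → line₃ xa xb ya yb ≡ true
line₃-intro {xa} {ya = ya} refl refl = cong₂ (λ p q → not p ∧ not q) (BP.xor-same xa) (BP.xor-same ya)

line₁-elim : ∀ {xa xb ya yb} → line₁ xa xb ya yb ≡ true → xb ≡ false × ya ≡ false
line₁-elim {xb = false} {false} _ = refl , refl

line₂-elim : ∀ {xa xb ya yb} → line₂ xa xb ya yb ≡ true → xa ≡ false × yb ≡ false
line₂-elim {false} {yb = false} _ = refl , refl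

line₃-elim : ∀ {xa xb ya yb} → line₃ xa xb ya yb ≡ true → xa ≡ xb × ya ≡ yb
line₃-elim {xa} {xb} {ya} {yb} e = xor≡false⇒≡ (BP.not-injective (∧≡true⇒ˡ e)) , xor≡false⇒≡ (BP.not-injective (∧≡true⇒ʳ e))

_==_ : Bool → Bool → Bool
x == y = not (x xor y)

-- Exchange law: if (x, y) ∈ ℓ and (z, w) ∈ ℓ′ are orthogonal for the symplectic form
-- ⟨x, w⟩ + ⟨z, y⟩, then one of them or their sum lies on ℓ″.
ExchangeLaw : Line → Line → Line → BoolFun 8
ExchangeLaw ℓ ℓ′ ℓ″ xa xb ya yb za zb wa wb =
  not (ℓ xa xb ya yb ∧ ℓ′ za zb wa wb ∧ (((xa ∧ wa) xor (xb ∧ wb)) == ((za ∧ ya) xor (zb ∧ yb))))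
  ∨ ℓ″ xa xb ya yb ∨ ℓ″ za zb wa wb ∨ ℓ″ (xa xor za) (xb xor zb) (ya xor wa) (yb xor wb)

-- Meet law: ℓ ∩ ℓ′ ⊆ ℓ″ (the two lines meet only in the origin).
MeetLaw : Line → Line → Line → BoolFun 4
MeetLaw ℓ ℓ′ ℓ″ xa xb ya yb = not (ℓ xa xb ya yb ∧ ℓ′ xa xb ya yb) ∨ ℓ″ xa xb ya yb

record Exchange (ℓ ℓ′ ℓ″ : Line) : Set where
  field
    exchange : ∀ xa xb ya yb za zb wa wb → ExchangeLaw ℓ ℓ′ ℓ″ xa xb ya yb za zb wa wb ≡ true
    meet     : ∀ xa xb ya yb → MeetLaw ℓ ℓ′ ℓ″ xa xb ya yb ≡ true

-- Any two of the three lines force the third.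
exchange₁₂ : Exchange line₁ line₂ line₃
exchange₁₂ = record { exchange = byTruthTable 8 ; meet = byTruthTable 4 }

exchange₃₂ : Exchange line₃ line₂ line₁
exchange₃₂ = record { exchange = byTruthTable 8 ; meet = byTruthTable 4 }

exchange₁₃ : Exchange line₁ line₃ line₂
exchange₁₃ = record { exchange = byTruthTable 8 ; meet = byTruthTable 4 }

modusPonens : ∀ {h₁ h₂ h₃ c} → (not (h₁ ∧ h₂ ∧ h₃) ∨ c) ≡ true → h₁ ≡ true → h₂ ≡ true → h₃ ≡ true → c ≡ true
modusPonens e refl refl refl = e

modusPonens₂ : ∀ {h₁ h₂ c} → (not (h₁ ∧ h₂) ∨ c) ≡ true → h₁ ≡ true → h₂ ≡ true → c ≡ true
modusPonens₂ e refl refl = e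

∨-elim₃ : ∀ {c₁ c₂ c₃} → (c₁ ∨ c₂ ∨ c₃) ≡ true → c₁ ≡ true ⊎ c₂ ≡ true ⊎ c₃ ≡ true
∨-elim₃ {true}                 _ = inj₁ refl
∨-elim₃ {false} {true}         _ = inj₂ (inj₁ refl)
∨-elim₃ {false} {false} {true} _ = inj₂ (inj₂ refl)

==-intro : ∀ {x y} → x ≡ y → (x == y) ≡ true
==-intro {x} refl = cong not (BP.xor-same x)

dot-cong : ∀ {n} (u v u′ v′ : Vector n) → (∀ i → lookup u i ∧ lookup v i ≡ lookup u′ i ∧ lookup v′ i) → dot u v ≡ dot u′ v′
dot-cong []      []      []        []        _ = refl
dot-cong (x ∷ u) (y ∷ v) (x′ ∷ u′) (y′ ∷ v′) h = cong₂ _xor_ (h zero) (dot-cong u v u′ v′ (h ∘ suc))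

dot-two : ∀ {n} {a b : Fin n} → a ≢ b → ∀ z y → (∀ i → a ≢ i → b ≢ i → lookup z i ∧ lookup y i ≡ false) →
  dot z y ≡ (lookup z a ∧ lookup y a) xor (lookup z b ∧ lookup y b)
dot-two {a = a} {b} a≢b z y outside = begin
  dot z y                                                       ≡⟨ dot-cong z y z′ y coordinate ⟩
  dot z′ y                                                      ≡⟨ dot-△ˡ (scale (lookup z a) ⁅ a ⁆) (scale (lookup z b) ⁅ b ⁆) y ⟩
  dot (scale (lookup z a) ⁅ a ⁆) y xor dot (scale (lookup z b) ⁅ b ⁆) y
    ≡⟨ cong₂ _xor_ (trans (dot-comm _ y) (dot-scale-unit y (lookup z a) a)) (trans (dot-comm _ y) (dot-scale-unit y (lookup z b) b)) ⟩
  (lookup z a ∧ lookup y a) xor (lookup z b ∧ lookup y b)       ∎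
  where
  open ≡-Reasoning
  z′ = scale (lookup z a) ⁅ a ⁆ △ scale (lookup z b) ⁅ b ⁆
  coordinate : ∀ i → lookup z i ∧ lookup y i ≡ lookup z′ i ∧ lookup y i
  coordinate i rewrite lookup-pair {a = a} {b} (lookup z a) (lookup z b) i with a FinP.≟ i | b FinP.≟ i
  ... | yes refl | yes refl = absurd (a≢b refl)
  ... | yes refl | no b≢i rewrite lookup-unit-≡ a | lookup-unit-≢ b≢i | BP.∧-zeroʳ (lookup z b) | BP.xor-identityʳ (lookup z a ∧ true) =
    cong (_∧ lookup y a) (sym (BP.∧-identityʳ _))
  ... | no a≢i | yes refl rewrite lookup-unit-≢ a≢i | lookup-unit-≡ b | BP.∧-zeroʳ (lookup z a) =
    cong (_∧ lookup y b) (sym (BP.∧-identityʳ _))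
  ... | no a≢i | no b≢i rewrite lookup-unit-≢ a≢i | lookup-unit-≢ b≢i | BP.∧-zeroʳ (lookup z a) | BP.∧-zeroʳ (lookup z b) =
    outside i a≢i b≢i

module Slide {n} {f : Vector n → Vector n} (lin : Linear f) (sa : SelfAdjoint f)
             {a b : Fin n} (a≢b : a ≢ b) where

  f′ : Vector n → Vector n
  f′ = slideMap a b f

  t : Vector n → Vector n
  t = addTo b a

  t-a : ∀ x → lookup (t x) a ≡ lookup x a
  t-a x = lookup-addTo-≢ a x (a≢b ∘ sym)

  t-b : ∀ x → lookup (t x) b ≡ lookup x b xor lookup x a
  t-b x = lookup-addTo-≡ b a x

  t-other : ∀ x {i} → b ≢ i → lookup (t x) i ≡ lookup x i
  t-other x b≢i = lookup-addTo-≢ a x b≢i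

  t-involutive : ∀ x → t (t x) ≡ x
  t-involutive x = ≐⇒≡ coordinate
    where
    coordinate : ∀ i → lookup (t (t x)) i ≡ lookup x i
    coordinate i with b FinP.≟ i
    ... | yes refl = trans (t-b (t x)) (trans (cong₂ _xor_ (t-b x) (t-a x)) (cancel (lookup x b) (lookup x a)))
      where
      cancel : ∀ x y → (x xor y) xor y ≡ x
      cancel = byTruthTable 2
    ... | no  b≢i  = trans (t-other (t x) b≢i) (t-other x b≢i)

  t-zero : ∀ x → IsZero x → IsZero (t x)
  t-zero x z i with b FinP.≟ i
  ... | yes refl = trans (t-b x) (cong₂ _xor_ (z b) (z a))
  ... | no  b≢i  = trans (t-other x b≢i) (z i)

  t-zero⁻¹ : ∀ x → IsZero (t x) → IsZero x
  t-zero⁻¹ x z = subst IsZero (t-involutive x) (t-zero (t x) z)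

  f′-a : ∀ x → lookup (f′ x) a ≡ lookup (f (t x)) a xor lookup (f (t x)) b
  f′-a x = lookup-addTo-≡ a b (f (t x))

  f′-other : ∀ x {i} → a ≢ i → lookup (f′ x) i ≡ lookup (f (t x)) i
  f′-other x a≢i = lookup-addTo-≢ b (f (t x)) a≢i

  -- If a ∉ Y, vectors supported in Y are fixed by t and f′ agrees with f on Y.
  outside : ∀ Y → lookup Y a ≡ false → D f′ Y ≡ D f Y
  outside Y Ya = D-cong (λ ns x s v → ns x s (λ i Yi → trans (agrees x s i Yi) (v i Yi)))
                        (λ ns x s v → ns x s (λ i Yi → trans (sym (agrees x s i Yi)) (v i Yi)))
    where
    fixed : ∀ x → SupportedIn x Y → t x ≡ x
    fixed x s = ≐⇒≡ coordinate
      where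
      xa : lookup x a ≡ false
      xa = BP.¬-not λ e → true≢false (trans (sym (s a e)) Ya)
      coordinate : ∀ i → lookup (t x) i ≡ lookup x i
      coordinate i with b FinP.≟ i
      ... | yes refl = trans (t-b x) (trans (cong (lookup x b xor_) xa) (BP.xor-identityʳ _))
      ... | no  b≢i  = t-other x b≢i
    agrees : ∀ x → SupportedIn x Y → ∀ i → lookup Y i ≡ true → lookup (f′ x) i ≡ lookup (f x) i
    agrees x s i Yi = trans (f′-other x a≢i) (cong (λ z → lookup (f z) i) (fixed x s))
      where
      a≢i : a ≢ i
      a≢i refl = true≢false (trans (sym Yi) Ya)

  -- If a, b ∈ Y, then t permutes the vectors supported in Y, and f′ x vanishes on Y
  -- exactly when f (t x) does.
  inside : ∀ Y → lookup Y a ≡ true → lookup Y b ≡ true → D f′ Y ≡ D f Y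
  inside Y Ya Yb = D-cong
    (λ ns x s v → t-zero⁻¹ x (ns (t x) (t-supported x s) (vanish⇒vanish′ x v)))
    (λ ns x s v → t-zero⁻¹ x (ns (t x) (t-supported x s) (vanish′⇒vanish x v)))
    where
    t-supported : ∀ x → SupportedIn x Y → SupportedIn (t x) Y
    t-supported x s i e with b FinP.≟ i
    ... | yes refl = Yb
    ... | no  b≢i  = s i (trans (sym (t-other x b≢i)) e)
    vanish′⇒vanish : ∀ x → VanishesOn (f′ x) Y → VanishesOn (f (t x)) Y
    vanish′⇒vanish x v i Yi with a FinP.≟ i
    ... | yes refl = trans (sym (BP.xor-identityʳ _))
                      (trans (cong (lookup (f (t x)) a xor_) (sym (trans (sym (f′-other x a≢b)) (v b Yb))))
                             (trans (sym (f′-a x)) (v a Ya)))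
    ... | no  a≢i  = trans (sym (f′-other x a≢i)) (v i Yi)
    vanish⇒vanish′ : ∀ x → VanishesOn (f x) Y → VanishesOn (f′ (t x)) Y
    vanish⇒vanish′ x v i Yi with a FinP.≟ i
    ... | yes refl = trans (f′-a (t x)) (trans (cong₂ (λ p q → lookup (f p) a xor lookup (f q) b) (t-involutive x) (t-involutive x))
                                               (cong₂ _xor_ (v a Ya) (v b Yb)))
    ... | no  a≢i  = trans (f′-other (t x) a≢i) (trans (cong (λ z → lookup (f z) i) (t-involutive x)) (v i Yi))

  -- Kernel vectors for Y, Y′ and (for f′) Y all live in the space of "admissible"
  -- vectors, supported in Y ∪ {b} with image vanishing on Y ∖ {a}; they are
  -- detected by the lines line₁, line₂, line₃ in the coordinates (z_a, z_b, (f z)_a, (f z)_b).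
  module Across (Y : Vector n) (Ya : lookup Y a ≡ true) (Yb : lookup Y b ≡ false) where

    C U Y′ : Vector n
    C  = Y [ a ]≔ false
    U  = Y [ b ]≔ true
    Y′ = C [ b ]≔ true

    C-a : lookup C a ≡ false
    C-a = VecP.lookup∘update a Y false

    C-other : ∀ {i} → a ≢ i → lookup C i ≡ lookup Y i
    C-other a≢i = VecP.lookup∘update′ (a≢i ∘ sym) Y false

    C-b : lookup C b ≡ false
    C-b = trans (C-other a≢b) Yb

    U-b : lookup U b ≡ true
    U-b = VecP.lookup∘update b Y true

    U-other : ∀ {i} → b ≢ i → lookup U i ≡ lookup Y i
    U-other b≢i = VecP.lookup∘update′ (b≢i ∘ sym) Y true

    Y′-b : lookup Y′ b ≡ true
    Y′-b = VecP.lookup∘update b C true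

    Y′-other : ∀ {i} → b ≢ i → lookup Y′ i ≡ lookup C i
    Y′-other b≢i = VecP.lookup∘update′ (b≢i ∘ sym) C true

    C∌a : ∀ i → lookup C i ≡ true → a ≢ i
    C∌a i Ci refl = true≢false (trans (sym Ci) C-a)

    C⊆Y : ∀ i → lookup C i ≡ true → lookup Y i ≡ true
    C⊆Y i Ci = trans (sym (C-other (C∌a i Ci))) Ci

    Y-a⊆C : ∀ i → a ≢ i → lookup Y i ≡ true → lookup C i ≡ true
    Y-a⊆C i a≢i Yi = trans (C-other a≢i) Yi

    Y⊆U : ∀ i → lookup Y i ≡ true → lookup U i ≡ true
    Y⊆U i Yi with b FinP.≟ i
    ... | yes refl = U-b
    ... | no  b≢i  = trans (U-other b≢i) Yi

    U-b⊆Y : ∀ i → b ≢ i → lookup U i ≡ true → lookup Y i ≡ true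
    U-b⊆Y i b≢i Ui = trans (sym (U-other b≢i)) Ui

    Y′⊆U : ∀ i → lookup Y′ i ≡ true → lookup U i ≡ true
    Y′⊆U i Y′i with b FinP.≟ i
    ... | yes refl = U-b
    ... | no  b≢i  = Y⊆U i (C⊆Y i (trans (sym (Y′-other b≢i)) Y′i))

    C⊆Y′ : ∀ i → lookup C i ≡ true → lookup Y′ i ≡ true
    C⊆Y′ i Ci with b FinP.≟ i
    ... | yes refl = Y′-b
    ... | no  b≢i  = trans (Y′-other b≢i) Ci

    off : ∀ (x Z : Vector n) i → SupportedIn x Z → lookup Z i ≡ false → lookup x i ≡ false
    off x Z i s Zi = BP.¬-not λ xi → true≢false (trans (sym (s i xi)) Zi)

    Admissible : Vector n → Set
    Admissible z = SupportedIn z U × VanishesOn (f z) C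

    admissible-△ : ∀ {z w} → Admissible z → Admissible w → Admissible (z △ w)
    admissible-△ {z} {w} (sz , vz) (sw , vw) = supported , vanishes
      where
      supported : SupportedIn (z △ w) U
      supported i e with lookup z i in zi
      ... | true  = sz i zi
      ... | false = sw i (trans (cong (_xor lookup w i) (sym zi)) (trans (sym (lookup-△ z w i)) e))
      vanishes : VanishesOn (f (z △ w)) C
      vanishes i Ci = trans (additive lin z w i) (cong₂ _xor_ (vz i Ci) (vw i Ci))

    OnLine : Line → Vector n → Set
    OnLine ℓ z = ℓ (lookup z a) (lookup z b) (lookup (f z) a) (lookup (f z) b) ≡ true

    onLine₁-intro : ∀ z → lookup z b ≡ false → lookup (f z) a ≡ false → OnLine line₁ z
    onLine₁-intro z = line₁-intro {lookup z a} {lookup z b} {lookup (f z) a} {lookup (f z) b}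

    onLine₂-intro : ∀ z → lookup z a ≡ false → lookup (f z) b ≡ false → OnLine line₂ z
    onLine₂-intro z = line₂-intro {lookup z a} {lookup z b} {lookup (f z) a} {lookup (f z) b}

    onLine₃-intro : ∀ z → lookup z a ≡ lookup z b → lookup (f z) a ≡ lookup (f z) b → OnLine line₃ z
    onLine₃-intro z = line₃-intro {lookup z a} {lookup z b} {lookup (f z) a} {lookup (f z) b}

    onLine₁ : ∀ z → OnLine line₁ z → lookup z b ≡ false × lookup (f z) a ≡ false
    onLine₁ z = line₁-elim {lookup z a} {lookup z b} {lookup (f z) a} {lookup (f z) b}

    onLine₂ : ∀ z → OnLine line₂ z → lookup z a ≡ false × lookup (f z) b ≡ false
    onLine₂ z = line₂-elim {lookup z a} {lookup z b} {lookup (f z) a} {lookup (f z) b}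

    onLine₃ : ∀ z → OnLine line₃ z → lookup z a ≡ lookup z b × lookup (f z) a ≡ lookup (f z) b
    onLine₃ z = line₃-elim {lookup z a} {lookup z b} {lookup (f z) a} {lookup (f z) b}

    Hit : Line → Set
    Hit ℓ = Σ _ λ z → Admissible z × OnLine ℓ z × NonZero z

    -- The coordinates of admissible vectors are isotropic for the symplectic form.
    isotropic : ∀ {z w} → Admissible z → Admissible w →
      (lookup z a ∧ lookup (f w) a) xor (lookup z b ∧ lookup (f w) b) ≡ (lookup w a ∧ lookup (f z) a) xor (lookup w b ∧ lookup (f z) b)
    isotropic {z} {w} az aw = trans (sym (dot-two a≢b z (f w) (disjoint az aw)))
                                    (trans (adjoint sa z w) (dot-two a≢b w (f z) (disjoint aw az)))
      where
      disjoint : ∀ {z w} → Admissible z → Admissible w → ∀ i → a ≢ i → b ≢ i → lookup z i ∧ lookup (f w) i ≡ false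
      disjoint {z} {w} (sz , _) (_ , vw) i a≢i b≢i with lookup z i in zi
      ... | false = refl
      ... | true  = vw i (Y-a⊆C i a≢i (U-b⊆Y i b≢i (sz i zi)))

    exchange : ∀ {ℓ ℓ′ ℓ″} → Exchange ℓ ℓ′ ℓ″ → Hit ℓ → Hit ℓ′ → Hit ℓ″
    exchange {ℓ} {ℓ′} {ℓ″} law (z , az , ℓz , nz) (w , aw , ℓ′w , nw)
      with ∨-elim₃ (modusPonens (Exchange.exchange law (lookup z a) (lookup z b) (lookup (f z) a) (lookup (f z) b)
                                                        (lookup w a) (lookup w b) (lookup (f w) a) (lookup (f w) b))
                                ℓz ℓ′w (==-intro (isotropic az aw)))
    ... | inj₁ ℓ″z        = z , az , ℓ″z , nz
    ... | inj₂ (inj₁ ℓ″w) = w , aw , ℓ″w , nw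
    ... | inj₂ (inj₂ ℓ″s) with FinP.any? (λ i → lookup (z △ w) i B.≟ true)
    ...   | yes ns = z △ w , admissible-△ az aw , onSum , ns
      where
      onSum : OnLine ℓ″ (z △ w)
      onSum rewrite lookup-△ z w a | lookup-△ z w b | additive lin z w a | additive lin z w b = ℓ″s
    ...   | no  zs = z , az , modusPonens₂ (Exchange.meet law (lookup z a) (lookup z b) (lookup (f z) a) (lookup (f z) b))
                                           ℓz (subst (OnLine ℓ′) (sym z≡w) ℓ′w) , nz
      where
      z≡w : z ≡ w
      z≡w = ≐⇒≡ λ i → xor≡false⇒≡ (trans (sym (lookup-△ z w i)) (BP.¬-not λ e → zs (i , e)))

    -- line₁ detects singularity of f on Y
    hit₁ : SingularOn f Y → Hit line₁
    hit₁ (x , s , v , nz) = x , ((λ i e → Y⊆U i (s i e)) , (λ i Ci → v i (C⊆Y i Ci))) , onLine₁-intro x (off x Y b s Yb) (v a Ya) , nz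

    unhit₁ : Hit line₁ → SingularOn f Y
    unhit₁ (z , (sz , vz) , on , nz) = z , supported , vanishes , nz
      where
      zb = proj₁ (onLine₁ z on)
      supported : SupportedIn z Y
      supported i e = U-b⊆Y i (λ { refl → true≢false (trans (sym e) zb) }) (sz i e)
      vanishes : VanishesOn (f z) Y
      vanishes i Yi with a FinP.≟ i
      ... | yes refl = proj₂ (onLine₁ z on)
      ... | no  a≢i  = vz i (Y-a⊆C i a≢i Yi)

    -- line₂ detects singularity of f on Y′
    hit₂ : SingularOn f Y′ → Hit line₂
    hit₂ (x , s , v , nz) = x , ((λ i e → Y′⊆U i (s i e)) , (λ i Ci → v i (C⊆Y′ i Ci)))
                          , onLine₂-intro x (off x Y′ a s (trans (Y′-other (a≢b ∘ sym)) C-a)) (v b Y′-b) , nz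

    unhit₂ : Hit line₂ → SingularOn f Y′
    unhit₂ (z , (sz , vz) , on , nz) = z , supported , vanishes , nz
      where
      za = proj₁ (onLine₂ z on)
      supported : SupportedIn z Y′
      supported i e with b FinP.≟ i
      ... | yes refl = Y′-b
      ... | no  b≢i  = trans (Y′-other b≢i) (Y-a⊆C i (λ { refl → true≢false (trans (sym e) za) }) (U-b⊆Y i b≢i (sz i e)))
      vanishes : VanishesOn (f z) Y′
      vanishes i Y′i with b FinP.≟ i
      ... | yes refl = proj₂ (onLine₂ z on)
      ... | no  b≢i  = vz i (trans (sym (Y′-other b≢i)) Y′i)

    -- line₃ detects singularity of f′ on Y, through the transvection t
    hit₃ : SingularOn f′ Y → Hit line₃
    hit₃ (x , s , v , (j , xj)) = t x , (supported , vanishes) , onLine₃-intro (t x) coordinates images , nonzero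
      where
      xb = off x Y b s Yb
      supported : SupportedIn (t x) U
      supported i e with b FinP.≟ i
      ... | yes refl = U-b
      ... | no  b≢i  = Y⊆U i (s i (trans (sym (t-other x b≢i)) e))
      vanishes : VanishesOn (f (t x)) C
      vanishes i Ci = trans (sym (f′-other x (C∌a i Ci))) (v i (C⊆Y i Ci))
      coordinates : lookup (t x) a ≡ lookup (t x) b
      coordinates = trans (t-a x) (sym (trans (t-b x) (cong (_xor lookup x a) xb)))
      images : lookup (f (t x)) a ≡ lookup (f (t x)) b
      images = xor≡false⇒≡ (trans (sym (f′-a x)) (v a Ya))
      nonzero : NonZero (t x)
      nonzero with b FinP.≟ j
      ... | yes refl = absurd (true≢false (trans (sym xj) xb))
      ... | no  b≢j  = j , trans (t-other x b≢j) xj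

    unhit₃ : Hit line₃ → SingularOn f′ Y
    unhit₃ (z , (sz , vz) , on , (j , zj)) = x , supported , vanishes , nonzero
      where
      x = t z
      tx≡z : t x ≡ z
      tx≡z = t-involutive z
      za≡zb = proj₁ (onLine₃ z on)
      xb : lookup x b ≡ false
      xb = trans (t-b z) (trans (cong (_xor lookup z a) (sym za≡zb)) (BP.xor-same (lookup z a)))
      supported : SupportedIn x Y
      supported i e with b FinP.≟ i
      ... | yes refl = absurd (true≢false (trans (sym e) xb))
      ... | no  b≢i  = U-b⊆Y i b≢i (sz i (trans (sym (t-other z b≢i)) e))
      vanishes-a : lookup (f′ x) a ≡ false
      vanishes-a = trans (f′-a x) (trans (cong (λ y → lookup (f y) a xor lookup (f y) b) tx≡z)
                                         (trans (cong (lookup (f z) a xor_) (sym (proj₂ (onLine₃ z on)))) (BP.xor-same (lookup (f z) a))))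
      vanishes : VanishesOn (f′ x) Y
      vanishes i Yi with a FinP.≟ i
      ... | yes refl = vanishes-a
      ... | no  a≢i  = trans (f′-other x a≢i) (trans (cong (λ y → lookup (f y) i) tx≡z) (vz i (Y-a⊆C i a≢i Yi)))
      nonzero : NonZero x
      nonzero with b FinP.≟ j
      ... | yes refl = a , trans (t-a z) (trans za≡zb zj)
      ... | no  b≢j  = j , trans (t-other z b≢j) zj

    -- A kernel vector r of f[C] is admissible with r_a = r_b = 0, and a point
    -- (0, 0, α, β) always lies on one of the lines.
    hitFromKernel : SingularOn f C → Hit line₁ ⊎ Hit line₂ ⊎ Hit line₃
    hitFromKernel (r , s , v , nz) = byImage (lookup (f r) a) (lookup (f r) b) refl refl
      where
      admissible : Admissible r
      admissible = (λ i e → Y⊆U i (C⊆Y i (s i e))) , v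
      ra = off r C a s C-a
      rb = off r C b s C-b
      byImage : ∀ α β → lookup (f r) a ≡ α → lookup (f r) b ≡ β → Hit line₁ ⊎ Hit line₂ ⊎ Hit line₃
      byImage false _     fa _  = inj₁ (r , admissible , onLine₁-intro r rb fa , nz)
      byImage true  false _  fb = inj₂ (inj₁ (r , admissible , onLine₂-intro r ra fb , nz))
      byImage true  true  fa fb = inj₂ (inj₂ (r , admissible , onLine₃-intro r (trans ra (sym rb)) (trans fa (sym fb)) , nz))

    through : ∀ {g} → PivotOf f C g → ∀ c → lookup C c ≡ false → lookup U c ≡ true →
      Σ _ λ z → Admissible z × (∀ d → lookup C d ≡ false → lookup z d ≡ lookup ⁅ c ⁆ d)
    through {g} piv c Cc Uc = z , (supported , vanishes) , outsideC
      where
      z = select C ⁅ c ⁆ (g ⁅ c ⁆)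
      outsideC : ∀ d → lookup C d ≡ false → lookup z d ≡ lookup ⁅ c ⁆ d
      outsideC d Cd = trans (lookup-select C ⁅ c ⁆ (g ⁅ c ⁆) d) (cong (if_then lookup (g ⁅ c ⁆) d else lookup ⁅ c ⁆ d) Cd)
      supported : SupportedIn z U
      supported i e with lookup C i in Ci
      ... | true  = Y⊆U i (C⊆Y i Ci)
      ... | false = subst (λ j → lookup U j ≡ true) (unit-member {a = c} {i} (trans (sym (outsideC i Ci)) e)) Uc
      vanishes : VanishesOn (f z) C
      vanishes i Ci = begin
        lookup (f z) i                                   ≡⟨ cong (λ y → lookup y i) (graph piv ⁅ c ⁆) ⟩
        lookup (select C (g ⁅ c ⁆) ⁅ c ⁆) i              ≡⟨ lookup-select C (g ⁅ c ⁆) ⁅ c ⁆ i ⟩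
        (if lookup C i then lookup ⁅ c ⁆ i else lookup (g ⁅ c ⁆) i)
                                                         ≡⟨ cong (if_then lookup ⁅ c ⁆ i else lookup (g ⁅ c ⁆) i) Ci ⟩
        lookup ⁅ c ⁆ i                                   ≡⟨ lookup-unit-≢ {a = c} {i} (λ { refl → true≢false (trans (sym Ci) Cc) }) ⟩
        false                                            ∎
        where open ≡-Reasoning

    -- If f[C] is nonsingular, the admissible vectors p through e_a and q through e_b
    -- have coordinates (1, 0, α, β) and (0, 1, β, δ) by isotropy; then p lies on
    -- line₁ (α = 0), q on line₂ (δ = 0), or p + q on line₃.
    hitFromPivot : ∀ {g} → PivotOf f C g → Hit line₁ ⊎ Hit line₂ ⊎ Hit line₃
    hitFromPivot piv = byImage (lookup (f p) a) (lookup (f q) b) refl refl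
      where
      P = through piv a C-a (Y⊆U a Ya)
      Q = through piv b C-b U-b
      p = proj₁ P
      q = proj₁ Q
      pa : lookup p a ≡ true
      pa = trans (proj₂ (proj₂ P) a C-a) (lookup-unit-≡ a)
      pb : lookup p b ≡ false
      pb = trans (proj₂ (proj₂ P) b C-b) (lookup-unit-≢ a≢b)
      qa : lookup q a ≡ false
      qa = trans (proj₂ (proj₂ Q) a C-a) (lookup-unit-≢ (a≢b ∘ sym))
      qb : lookup q b ≡ true
      qb = trans (proj₂ (proj₂ Q) b C-b) (lookup-unit-≡ b)
      cross : lookup (f q) a ≡ lookup (f p) b
      cross = begin
        lookup (f q) a                                                      ≡⟨ solve (lookup (f q) a) (lookup (f q) b) ⟩
        (true ∧ lookup (f q) a) xor (false ∧ lookup (f q) b)                ≡⟨ cong₂ (λ x y → (x ∧ lookup (f q) a) xor (y ∧ lookup (f q) b)) (sym pa) (sym pb) ⟩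
        (lookup p a ∧ lookup (f q) a) xor (lookup p b ∧ lookup (f q) b)     ≡⟨ isotropic (proj₁ (proj₂ P)) (proj₁ (proj₂ Q)) ⟩
        (lookup q a ∧ lookup (f p) a) xor (lookup q b ∧ lookup (f p) b)     ≡⟨ cong₂ (λ x y → (x ∧ lookup (f p) a) xor (y ∧ lookup (f p) b)) qa qb ⟩
        lookup (f p) b                                                      ∎
        where
        open ≡-Reasoning
        solve : ∀ x y → x ≡ (true ∧ x) xor (false ∧ y)
        solve = byTruthTable 2
      byImage : ∀ α δ → lookup (f p) a ≡ α → lookup (f q) b ≡ δ → Hit line₁ ⊎ Hit line₂ ⊎ Hit line₃
      byImage false _     fpa _   = inj₁ (p , proj₁ (proj₂ P) , onLine₁-intro p pb fpa , a , pa)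
      byImage true  false _   fqb = inj₂ (inj₁ (q , proj₁ (proj₂ Q) , onLine₂-intro q qa fqb , b , qb))
      byImage true  true  fpa fqb = inj₂ (inj₂ (p △ q , admissible-△ (proj₁ (proj₂ P)) (proj₁ (proj₂ Q)) ,
                                                onLine₃-intro (p △ q) coordinates images , a , sumA))
        where
        sumA : lookup (p △ q) a ≡ true
        sumA = trans (lookup-△ p q a) (cong₂ _xor_ pa qa)
        coordinates : lookup (p △ q) a ≡ lookup (p △ q) b
        coordinates = trans sumA (sym (trans (lookup-△ p q b) (cong₂ _xor_ pb qb)))
        images : lookup (f (p △ q)) a ≡ lookup (f (p △ q)) b
        images = begin
          lookup (f (p △ q)) a                 ≡⟨ additive lin p q a ⟩
          lookup (f p) a xor lookup (f q) a    ≡⟨ cong₂ _xor_ fpa cross ⟩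
          true xor lookup (f p) b              ≡⟨ BP.xor-comm true (lookup (f p) b) ⟩
          lookup (f p) b xor true              ≡⟨ cong (lookup (f p) b xor_) (sym fqb) ⟩
          lookup (f p) b xor lookup (f q) b    ≡⟨ sym (additive lin p q b) ⟩
          lookup (f (p △ q)) b                 ∎
          where open ≡-Reasoning

    someHit : Hit line₁ ⊎ Hit line₂ ⊎ Hit line₃
    someHit with nonsingular-or-singular f C
    ... | inj₂ singular    = hitFromKernel singular
    ... | inj₁ nonsingular = hitFromPivot (proj₂ (pivot-exists lin sa C nonsingular))

    parity : D f′ Y ≡ D f Y xor D f Y′
    parity = byCases (nonsingular-or-singular f Y) (nonsingular-or-singular f Y′)
     where
     byCases : NonsingularOn f Y ⊎ SingularOn f Y → NonsingularOn f Y′ ⊎ SingularOn f Y′ → D f′ Y ≡ D f Y xor D f Y′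
     byCases (inj₁ ns₁) (inj₁ ns₂) = trans (D-false {f = f′} {Y} (unhit₃ third)) (sym (cong₂ _xor_ (D-true ns₁) (D-true ns₂)))
       where
       third : Hit line₃
       third with someHit
       ... | inj₁ h        = absurd (singular⇒¬nonsingular {f = f} {Y} (unhit₁ h) ns₁)
       ... | inj₂ (inj₁ h) = absurd (singular⇒¬nonsingular {f = f} {Y′} (unhit₂ h) ns₂)
       ... | inj₂ (inj₂ h) = h
     byCases (inj₁ ns₁) (inj₂ s₂) = trans (D-true nonsingular′) (sym (cong₂ _xor_ (D-true ns₁) (D-false {f = f} {Y′} s₂)))
       where
       nonsingular′ : NonsingularOn f′ Y
       nonsingular′ with nonsingular-or-singular f′ Y
       ... | inj₁ ns = ns
       ... | inj₂ s₃ = absurd (singular⇒¬nonsingular {f = f} {Y} (unhit₁ (exchange exchange₃₂ (hit₃ s₃) (hit₂ s₂))) ns₁)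
     byCases (inj₂ s₁) (inj₁ ns₂) = trans (D-true nonsingular′) (sym (cong₂ _xor_ (D-false {f = f} {Y} s₁) (D-true ns₂)))
       where
       nonsingular′ : NonsingularOn f′ Y
       nonsingular′ with nonsingular-or-singular f′ Y
       ... | inj₁ ns = ns
       ... | inj₂ s₃ = absurd (singular⇒¬nonsingular {f = f} {Y′} (unhit₂ (exchange exchange₁₃ (hit₁ s₁) (hit₃ s₃))) ns₂)
     byCases (inj₂ s₁) (inj₂ s₂) = trans (D-false {f = f′} {Y} (unhit₃ (exchange exchange₁₂ (hit₁ s₁) (hit₂ s₂))))
                                     (sym (cong₂ _xor_ (D-false {f = f} {Y} s₁) (D-false {f = f} {Y′} s₂)))

  t-unit : ∀ q → a ≢ q → t ⁅ q ⁆ ≡ ⁅ q ⁆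
  t-unit q a≢q = ≐⇒≡ coordinate
    where
    coordinate : ∀ i → lookup (t ⁅ q ⁆) i ≡ lookup ⁅ q ⁆ i
    coordinate i with b FinP.≟ i
    ... | yes refl = trans (t-b ⁅ q ⁆) (trans (cong (lookup ⁅ q ⁆ b xor_) (lookup-unit-≢ (a≢q ∘ sym))) (BP.xor-identityʳ _))
    ... | no  b≢i  = t-other ⁅ q ⁆ b≢i

  t-unit-a : t ⁅ a ⁆ ≡ ⁅ a ⁆ △ ⁅ b ⁆
  t-unit-a = ≐⇒≡ coordinate
    where
    coordinate : ∀ i → lookup (t ⁅ a ⁆) i ≡ lookup (⁅ a ⁆ △ ⁅ b ⁆) i
    coordinate i with b FinP.≟ i
    ... | yes refl = trans (t-b ⁅ a ⁆) (trans (cong (lookup ⁅ a ⁆ b xor_) (trans (lookup-unit-≡ a) (sym (lookup-unit-≡ b)))) (sym (lookup-△ ⁅ a ⁆ ⁅ b ⁆ b)))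
    ... | no  b≢i  = trans (t-other ⁅ a ⁆ b≢i) (sym (trans (lookup-△ ⁅ a ⁆ ⁅ b ⁆ i)
                       (trans (cong (lookup ⁅ a ⁆ i xor_) (lookup-unit-≢ b≢i)) (BP.xor-identityʳ _))))

  entry-unchanged : ∀ {p q} → a ≢ p → a ≢ q → entry f′ p q ≡ entry f p q
  entry-unchanged {p} {q} a≢p a≢q = trans (f′-other ⁅ q ⁆ a≢p) (cong (λ z → lookup (f z) p) (t-unit q a≢q))

  entry-column : ∀ {p} → a ≢ p → entry f′ p a ≡ entry f p a xor entry f p b
  entry-column {p} a≢p = trans (f′-other ⁅ a ⁆ a≢p) (trans (cong (λ z → lookup (f z) p) t-unit-a) (additive lin ⁅ a ⁆ ⁅ b ⁆ p))

  entry-corner : entry f′ a a ≡ (entry f a a xor entry f a b) xor (entry f b a xor entry f b b)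
  entry-corner = trans (f′-a ⁅ a ⁆) (cong₂ _xor_ (trans (cong (λ z → lookup (f z) a) t-unit-a) (additive lin ⁅ a ⁆ ⁅ b ⁆ a))
                                                 (trans (cong (λ z → lookup (f z) b) t-unit-a) (additive lin ⁅ a ⁆ ⁅ b ⁆ b)))

  slide-D : ∀ Y → slide a b (D f) Y ≡ D f′ Y
  slide-D Y with lookup Y a in Ya | lookup Y b in Yb
  ... | false | _     = trans (BP.xor-identityʳ (D f Y)) (sym (outside Y Ya))
  ... | true  | true  = trans (BP.xor-identityʳ (D f Y)) (sym (inside Y Ya Yb))
  ... | true  | false = sym (Across.parity Y Ya Yb)

  slide-represents : ∀ {F} → Represents f F → Represents f′ (slide a b F)
  slide-represents {F} rep Y =
    trans (cong₂ (λ p q → p xor (lookup Y a ∧ (not (lookup Y b) ∧ q))) (rep Y) (rep ((Y [ a ]≔ false) [ b ]≔ true)))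
          (slide-D Y)

index-cases : ∀ p {m} (i : Fin (p + m)) → (∃ λ j → j ↑ˡ m ≡ i) ⊎ (∃ λ k → p ↑ʳ k ≡ i)
index-cases p i with Fin.splitAt p i in eq
... | inj₁ j = inj₁ (j , FinP.splitAt⁻¹-↑ˡ eq)
... | inj₂ k = inj₂ (k , FinP.splitAt⁻¹-↑ʳ eq)

++-pointwise : ∀ {p m} (P : Bool → Bool → Set) (xs X : Vector p) (ys Y : Vector m) →
  (∀ i → P (lookup xs i) (lookup X i)) → (∀ k → P (lookup ys k) (lookup Y k)) →
  ∀ i → P (lookup (xs ++ ys) i) (lookup (X ++ Y) i)
++-pointwise {p} {m} P xs X ys Y left right i with index-cases p i
... | inj₁ (j , refl) = subst₂ P (sym (VecP.lookup-++ˡ xs ys j)) (sym (VecP.lookup-++ˡ X Y j)) (left j)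
... | inj₂ (k , refl) = subst₂ P (sym (VecP.lookup-++ʳ xs ys k)) (sym (VecP.lookup-++ʳ X Y k)) (right k)

++-left : ∀ {p m} (P : Bool → Bool → Set) (xs X : Vector p) (ys Y : Vector m) →
  (∀ i → P (lookup (xs ++ ys) i) (lookup (X ++ Y) i)) → ∀ j → P (lookup xs j) (lookup X j)
++-left {m = m} P xs X ys Y h j = subst₂ P (VecP.lookup-++ˡ xs ys j) (VecP.lookup-++ˡ X Y j) (h (j ↑ˡ m))

++-right : ∀ {p m} (P : Bool → Bool → Set) (xs X : Vector p) (ys Y : Vector m) →
  (∀ i → P (lookup (xs ++ ys) i) (lookup (X ++ Y) i)) → ∀ k → P (lookup ys k) (lookup Y k)
++-right {p} P xs X ys Y h k = subst₂ P (VecP.lookup-++ʳ xs ys k) (VecP.lookup-++ʳ X Y k) (h (p ↑ʳ k))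

supportBit vanishBit zeroBit : Bool → Bool → Set
supportBit x z = x ≡ true → z ≡ true
vanishBit y z = z ≡ true → y ≡ false
zeroBit x _ = x ≡ false

⊥-++ : ∀ p {m} → ⊥ {p + m} ≡ ⊥ {p} ++ ⊥ {m}
⊥-++ zero    = refl
⊥-++ (suc p) = cong (false ∷_) (⊥-++ p)

module DirectSum (p : ℕ) {m} {f : Vector (p + m) → Vector (p + m)} {g : Vector p → Vector p} {h : Vector m → Vector m}
                 (g-⊥ : IsZero (g ⊥)) (h-⊥ : IsZero (h ⊥)) (splits : ∀ xs ys → f (xs ++ ys) ≡ g xs ++ h ys) where

  nonsingular⇒ : ∀ X Y → NonsingularOn f (X ++ Y) → NonsingularOn g X × NonsingularOn h Y
  nonsingular⇒ X Y ns = first , second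
    where
    first : NonsingularOn g X
    first xs s v = ++-left (λ x _ → zeroBit x x) xs xs ⊥ ⊥ (λ i → ns (xs ++ ⊥)
      (++-pointwise supportBit xs X ⊥ Y s (λ k e → absurd (true≢false (trans (sym e) (lookup-⊥ k)))))
      (λ i e → subst (λ z → lookup z i ≡ false) (sym (splits xs ⊥))
         (++-pointwise vanishBit (g xs) X (h ⊥) Y v (λ k _ → h-⊥ k) i e)) i)
    second : NonsingularOn h Y
    second ys s v = ++-right (λ x _ → zeroBit x x) ⊥ ⊥ ys ys (λ i → ns (⊥ ++ ys)
      (++-pointwise supportBit ⊥ X ys Y (λ k e → absurd (true≢false (trans (sym e) (lookup-⊥ k)))) s)
      (λ i e → subst (λ z → lookup z i ≡ false) (sym (splits ⊥ ys))
         (++-pointwise vanishBit (g ⊥) X (h ys) Y (λ k _ → g-⊥ k) v i e)) i)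

  nonsingular⇐ : ∀ X Y → NonsingularOn g X → NonsingularOn h Y → NonsingularOn f (X ++ Y)
  nonsingular⇐ X Y nsg nsh v = subst (λ w → SupportedIn w (X ++ Y) → VanishesOn (f w) (X ++ Y) → IsZero w)
                                     (VecP.take++drop≡id p v) (split (take p v) (drop p v))
    where
    split : ∀ xs ys → SupportedIn (xs ++ ys) (X ++ Y) → VanishesOn (f (xs ++ ys)) (X ++ Y) → IsZero (xs ++ ys)
    split xs ys s v = ++-pointwise (λ x _ → zeroBit x x) xs xs ys ys
      (nsg xs (++-left supportBit xs X ys Y s) (++-left vanishBit (g xs) X (h ys) Y v′))
      (nsh ys (++-right supportBit xs X ys Y s) (++-right vanishBit (g xs) X (h ys) Y v′))
      where
      v′ : VanishesOn (g xs ++ h ys) (X ++ Y)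
      v′ = subst (λ z → VanishesOn z (X ++ Y)) (splits xs ys) v

  D-++ : ∀ X Y → D f (X ++ Y) ≡ D g X ∧ D h Y
  D-++ X Y with nonsingular? g X | nonsingular? h Y
  ... | yes nsg | yes nsh = D-true (nonsingular⇐ X Y nsg nsh)
  ... | no ¬nsg | _       = BP.¬-not λ e → ¬nsg (proj₁ (nonsingular⇒ X Y (D-true⁻¹ e)))
  ... | yes _   | no ¬nsh = BP.¬-not λ e → ¬nsh (proj₂ (nonsingular⇒ X Y (D-true⁻¹ e)))

unit-↑ˡ : ∀ {p} m (j : Fin p) → ⁅ j ↑ˡ m ⁆ ≡ ⁅ j ⁆ ++ ⊥ {m}
unit-↑ˡ {suc p} m zero    = cong (true ∷_) (⊥-++ p)
unit-↑ˡ {suc p} m (suc j) = cong (false ∷_) (unit-↑ˡ m j)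

dot-++ : ∀ {p m} (xs us : Vector p) (ys vs : Vector m) → dot (xs ++ ys) (us ++ vs) ≡ dot xs us xor dot ys vs
dot-++ []       []       ys vs = refl
dot-++ (x ∷ xs) (u ∷ us) ys vs = trans (cong ((x ∧ u) xor_) (dot-++ xs us ys vs)) (sym (BP.xor-assoc (x ∧ u) _ _))

△-++ : ∀ {p m} (xs us : Vector p) (ys vs : Vector m) → (xs ++ ys) △ (us ++ vs) ≡ (xs △ us) ++ (ys △ vs)
△-++ xs us ys vs = VecP.zipWith-++ _xor_ xs ys us vs

module Split (p : ℕ) {m} {f : Vector (p + m) → Vector (p + m)} (lin : Linear f) (sa : SelfAdjoint f)
             (g : Vector p → Vector p) (block : ∀ xs → f (xs ++ ⊥) ≡ g xs ++ ⊥) where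

  rest : Vector m → Vector m
  rest ys = drop p (f (⊥ ++ ys))

  -- by self-adjointness, f maps the last m coordinates into themselves
  tail-block : ∀ ys → f (⊥ ++ ys) ≡ ⊥ ++ rest ys
  tail-block ys = trans (sym (VecP.take++drop≡id p (f (⊥ ++ ys)))) (cong (_++ rest ys) (≐⇒≡ front))
    where
    v = f (⊥ ++ ys)
    front : ∀ j → lookup (take p v) j ≡ lookup ⊥ j
    front j = begin
      lookup (take p v) j                 ≡⟨ sym (VecP.lookup-++ˡ (take p v) (drop p v) j) ⟩
      lookup (take p v ++ drop p v) (j ↑ˡ m)
                                                   ≡⟨ cong (λ w → lookup w (j ↑ˡ m)) (VecP.take++drop≡id p v) ⟩
      lookup v (j ↑ˡ m)                            ≡⟨ sym (dot-unit (j ↑ˡ m) v) ⟩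
      dot ⁅ j ↑ˡ m ⁆ v                             ≡⟨ adjoint sa ⁅ j ↑ˡ m ⁆ (⊥ ++ ys) ⟩
      dot (⊥ ++ ys) (f ⁅ j ↑ˡ m ⁆)                 ≡⟨ cong (λ w → dot (⊥ ++ ys) (f w)) (unit-↑ˡ m j) ⟩
      dot (⊥ ++ ys) (f (⁅ j ⁆ ++ ⊥))               ≡⟨ cong (dot (⊥ ++ ys)) (block ⁅ j ⁆) ⟩
      dot (⊥ ++ ys) (g ⁅ j ⁆ ++ ⊥)                 ≡⟨ dot-++ ⊥ (g ⁅ j ⁆) ys ⊥ ⟩
      dot ⊥ (g ⁅ j ⁆) xor dot ys ⊥                 ≡⟨ cong₂ _xor_ (dot-⊥ˡ (g ⁅ j ⁆)) (dot-⊥ʳ ys) ⟩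
      false                                        ≡⟨ sym (lookup-⊥ j) ⟩
      lookup ⊥ j                                   ∎
      where open ≡-Reasoning

  splits : ∀ xs ys → f (xs ++ ys) ≡ g xs ++ rest ys
  splits xs ys = begin
    f (xs ++ ys)                                   ≡⟨ cong f (sym (trans (△-++ xs ⊥ ⊥ ys) (cong₂ _++_ (△-identityʳ xs) (△-identityˡ ys)))) ⟩
    f ((xs ++ ⊥) △ (⊥ ++ ys))                      ≡⟨ linear-△ lin (xs ++ ⊥) (⊥ ++ ys) ⟩
    f (xs ++ ⊥) △ f (⊥ ++ ys)                      ≡⟨ cong₂ _△_ (block xs) (tail-block ys) ⟩
    (g xs ++ ⊥) △ (⊥ ++ rest ys)                   ≡⟨ trans (△-++ (g xs) ⊥ ⊥ (rest ys)) (cong₂ _++_ (△-identityʳ (g xs)) (△-identityˡ (rest ys))) ⟩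
    g xs ++ rest ys                                ∎
    where open ≡-Reasoning

  lookup-rest : ∀ ys k → lookup (rest ys) k ≡ lookup (f (⊥ ++ ys)) (p ↑ʳ k)
  lookup-rest ys k = trans (sym (VecP.lookup-++ʳ (⊥ {p}) (rest ys) k)) (cong (λ w → lookup w (p ↑ʳ k)) (sym (tail-block ys)))

  rest-linear : Linear rest
  rest-linear = linear λ u w k → begin
    lookup (rest (u △ w)) k                                       ≡⟨ lookup-rest (u △ w) k ⟩
    lookup (f (⊥ ++ (u △ w))) (p ↑ʳ k)                            ≡⟨ cong (λ z → lookup (f (z ++ (u △ w))) (p ↑ʳ k)) (sym (△-self (⊥ {p}))) ⟩
    lookup (f ((⊥ △ ⊥) ++ (u △ w))) (p ↑ʳ k)                      ≡⟨ cong (λ z → lookup (f z) (p ↑ʳ k)) (sym (△-++ ⊥ ⊥ u w)) ⟩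
    lookup (f ((⊥ ++ u) △ (⊥ ++ w))) (p ↑ʳ k)                     ≡⟨ additive lin (⊥ ++ u) (⊥ ++ w) (p ↑ʳ k) ⟩
    lookup (f (⊥ ++ u)) (p ↑ʳ k) xor lookup (f (⊥ ++ w)) (p ↑ʳ k) ≡⟨ sym (cong₂ _xor_ (lookup-rest u k) (lookup-rest w k)) ⟩
    lookup (rest u) k xor lookup (rest w) k                       ∎
    where open ≡-Reasoning

  rest-selfAdjoint : SelfAdjoint rest
  rest-selfAdjoint = selfAdjoint λ u w → begin
    dot u (rest w)                       ≡⟨ embed u w ⟩
    dot (⊥ ++ u) (f (⊥ ++ w))            ≡⟨ adjoint sa (⊥ ++ u) (⊥ ++ w) ⟩
    dot (⊥ ++ w) (f (⊥ ++ u))            ≡⟨ sym (embed w u) ⟩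
    dot w (rest u)                       ∎
    where
    open ≡-Reasoning
    embed : ∀ u w → dot u (rest w) ≡ dot (⊥ ++ u) (f (⊥ ++ w))
    embed u w = sym (trans (cong (dot (⊥ ++ u)) (tail-block w)) (trans (dot-++ (⊥ {p}) ⊥ u (rest w)) (cong (_xor dot u (rest w)) (dot-⊥ˡ (⊥ {p})))))

  g-⊥ : IsZero (g ⊥)
  g-⊥ j = trans (sym (VecP.lookup-++ˡ (g ⊥) ⊥ j))
                (trans (cong (λ w → lookup w (j ↑ˡ m)) (sym (trans (cong f (⊥-++ p)) (block ⊥)))) (linear-⊥ lin (j ↑ˡ m)))

  D-split : ∀ X Y → D f (X ++ Y) ≡ D g X ∧ D rest Y
  D-split = DirectSum.D-++ p g-⊥ (linear-⊥ rest-linear) splits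

∉-All : ∀ {n} {P : Fin n → Set} x {L : List (Fin n)} → All P L → (∀ {j} → P j → j ≢ x) → x ∉ L
∉-All x (px ∷ _)   rule (here refl) = rule px refl
∉-All x (_  ∷ all) rule (there x∈L) = ∉-All x all rule x∈L

_∈?_ : ∀ {n} (x : Fin n) (L : List (Fin n)) → Dec (x ∈ L)
_∈?_ {n} = DecMembership._∈?_ (FinP._≟_ {n})

≢-head : ∀ {n} {j p : Fin n} {L} → p ∉ j ∷ L → j ≢ p
≢-head p∉ refl = p∉ (here refl)

-- Reduction to normal form.  A set system reached from B₀ by handle slides is
-- carried together with a self-adjoint linear map representing it.
record Reached {n} (B₀ : Family n) : Set where
  field
    family      : Family n
    repMap      : Vector n → Vector n
    isLinear    : Linear repMap
    isSelfAdj   : SelfAdjoint repMap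
    represents  : Represents repMap family
    path        : Slides B₀ family
open Reached

start : ∀ {n} {B : Family n} {f : Vector n → Vector n} → Linear f → SelfAdjoint f → Represents f B → Reached B
start {B = B} {f} lin sa rep = record
  { family = B ; repMap = f ; isLinear = lin ; isSelfAdj = sa ; represents = rep ; path = ε }

Entry : ∀ {n} {B₀ : Family n} → Reached B₀ → Fin n → Fin n → Bool
Entry st = entry (repMap st)

Entry-sym : ∀ {n} {B₀ : Family n} (st : Reached B₀) p q → Entry st p q ≡ Entry st q p
Entry-sym st = entry-sym (isSelfAdj st)

slideStep : ∀ {n} {B₀ : Family n} → Reached B₀ → (a b : Fin n) → a ≢ b → Reached B₀
slideStep st a b a≢b = record
  { family     = slide a b (family st)
  ; repMap     = slideMap a b (repMap st)
  ; isLinear   = slideMap-linear (isLinear st) a b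
  ; isSelfAdj  = slideMap-selfAdjoint (isSelfAdj st) a b
  ; represents = Slide.slide-represents (isLinear st) (isSelfAdj st) a≢b (represents st)
  ; path       = path st ◅◅ ((a , b , a≢b , refl) ◅ ε)
  }

module _ {n} {B₀ : Family n} (st : Reached B₀) {a b : Fin n} (a≢b : a ≢ b) where
  private module S = Slide (isLinear st) (isSelfAdj st) a≢b

  step-unchanged : ∀ {p q} → a ≢ p → a ≢ q → Entry (slideStep st a b a≢b) p q ≡ Entry st p q
  step-unchanged = S.entry-unchanged

  step-column : ∀ {p} → a ≢ p → Entry (slideStep st a b a≢b) p a ≡ Entry st p a xor Entry st p b
  step-column = S.entry-column

  step-corner : Entry (slideStep st a b a≢b) a a ≡ (Entry st a a xor Entry st a b) xor (Entry st b a xor Entry st b b)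
  step-corner = S.entry-corner

-- Clearing row r against a pivot entry (r, s) = 1: sliding each j ∈ L with
-- entry (r, j) = 1 over s clears row r on L.
record Cleared {n} {B₀ : Family n} (st : Reached B₀) (r s : Fin n) (L : List (Fin n)) : Set where
  field
    result    : Reached B₀
    outside   : ∀ p q → p ∉ L → q ∉ L → Entry result p q ≡ Entry st p q
    untouched : ∀ p q → p ∉ L → Entry st p s ≡ false → Entry result p q ≡ Entry st p q
    cleared   : ∀ j → j ∈ L → Entry result r j ≡ false

clearOne : ∀ {n} {B₀ : Family n} (st : Reached B₀) r s j → j ≢ r → j ≢ s → Entry st r s ≡ true →
  Cleared st r s (j ∷ [])
clearOne st r s j j≢r j≢s ers with Entry st r j B.≟ true
... | no  erj = record
  { result = st ; outside = λ _ _ _ _ → refl ; untouched = λ _ _ _ _ → refl ; cleared = λ { _ (here refl) → BP.¬-not erj } }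
... | yes erj = record
  { result    = slideStep st j s j≢s
  ; outside   = λ p q p∉ q∉ → step-unchanged st j≢s (≢-head p∉) (≢-head q∉)
  ; untouched = untouched
  ; cleared   = λ { _ (here refl) → trans (step-column st j≢s j≢r) (cong₂ _xor_ erj ers) }
  }
  where
  untouched : ∀ p q → p ∉ j ∷ [] → Entry st p s ≡ false → Entry (slideStep st j s j≢s) p q ≡ Entry st p q
  untouched p q p∉ eps with j FinP.≟ q
  ... | yes refl = trans (step-column st j≢s (≢-head p∉)) (trans (cong (Entry st p j xor_) eps) (BP.xor-identityʳ _))
  ... | no  j≢q  = step-unchanged st j≢s (≢-head p∉) j≢q

Cleared-∷ : ∀ {n} {B₀ : Family n} {st : Reached B₀} {r s j : Fin n} {L} → j ≢ s → r ∉ L →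
  (first : Cleared st r s (j ∷ [])) → Cleared (Cleared.result first) r s L → Cleared st r s (j ∷ L)
Cleared-∷ {st = st} {r} {s} {j} {L} j≢s r∉L first later = record
  { result    = Later.result
  ; outside   = λ p q p∉ q∉ → trans (Later.outside p q (p∉ ∘ there) (q∉ ∘ there)) (First.outside p q (only p∉) (only q∉))
  ; untouched = λ p q p∉ eps → trans (Later.untouched p q (p∉ ∘ there) (trans (First.outside p s (only p∉) s∉) eps))
                                     (First.untouched p q (only p∉) eps)
  ; cleared   = cleared
  }
  where
  module First = Cleared first
  module Later = Cleared later
  only : ∀ {p} → p ∉ j ∷ L → p ∉ j ∷ []
  only p∉ (here e) = p∉ (here e)
  s∉ : s ∉ j ∷ []
  s∉ (here s≡j) = j≢s (sym s≡j)
  cleared : ∀ j′ → j′ ∈ j ∷ L → Entry Later.result r j′ ≡ false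
  cleared j′ (there j′∈L) = Later.cleared j′ j′∈L
  cleared j′ (here refl) with j′ ∈? L
  ... | yes j′∈L = Later.cleared j′ j′∈L
  ... | no  j′∉L = trans (Later.outside r j′ r∉L j′∉L) (First.cleared j′ (here refl))

clearRow : ∀ {n} {B₀ : Family n} (st : Reached B₀) r s (L : List (Fin n)) →
  All (λ j → j ≢ r × j ≢ s) L → Entry st r s ≡ true → Cleared st r s L
clearRow st r s []      _                    _   = record
  { result = st ; outside = λ _ _ _ _ → refl ; untouched = λ _ _ _ _ → refl ; cleared = λ _ () }
clearRow st r s (j ∷ L) ((j≢r , j≢s) ∷ rest) ers = Cleared-∷ j≢s (∉-All r rest proj₁) first
  (clearRow (Cleared.result first) r s L rest
    (trans (Cleared.outside first r s (λ { (here r≡j) → j≢r (sym r≡j) }) (λ { (here s≡j) → j≢s (sym s≡j) })) ers))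
  where
  first = clearOne st r s j j≢r j≢s ers

loopBlock freeBlock : Vector 1 → Vector 1
loopBlock _ = ⊥
freeBlock x = x

pairBlock : Vector 2 → Vector 2
pairBlock (x ∷ y ∷ []) = y ∷ x ∷ []

loopBlock-D : ∀ X → D loopBlock X ≡ loopFam X
loopBlock-D (false ∷ []) = refl
loopBlock-D (true  ∷ []) = refl

freeBlock-D : ∀ X → D freeBlock X ≡ freeFam X
freeBlock-D (false ∷ []) = refl
freeBlock-D (true  ∷ []) = refl

pairBlock-D : ∀ X → D pairBlock X ≡ pairFam X
pairBlock-D (false ∷ false ∷ []) = refl
pairBlock-D (false ∷ true  ∷ []) = refl
pairBlock-D (true  ∷ false ∷ []) = refl
pairBlock-D (true  ∷ true  ∷ []) = refl

slide-++ : ∀ {p m} (P : Family (p + m)) (c : Vector p → Bool) (K : Family m) →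
  (∀ xs Y → P (xs ++ Y) ≡ c xs ∧ K Y) →
  ∀ a b xs Y → slide (p ↑ʳ a) (p ↑ʳ b) P (xs ++ Y) ≡ c xs ∧ slide a b K Y
slide-++ P c K split a b xs Y
  rewrite VecP.lookup-++ʳ xs Y a | VecP.lookup-++ʳ xs Y b | VecP.[]≔-++-↑ʳ {y = false} xs Y a
        | VecP.[]≔-++-↑ʳ {y = true} xs (Y [ a ]≔ false) b | split xs Y | split xs ((Y [ a ]≔ false) [ b ]≔ true)
  = factor (c xs) (K Y) (lookup Y a) (not (lookup Y b)) (K ((Y [ a ]≔ false) [ b ]≔ true))
  where
  factor : ∀ c k x y k′ → (c ∧ k) xor (x ∧ (y ∧ (c ∧ k′))) ≡ c ∧ (k xor (x ∧ (y ∧ k′)))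
  factor = byTruthTable 5

liftSlides : ∀ {p m} {K K′ : Family m} (c : Vector p → Bool) → Slides K K′ → (P : Family (p + m)) →
  (∀ xs Y → P (xs ++ Y) ≡ c xs ∧ K Y) →
  Σ (Family (p + m)) λ P′ → Slides P P′ × (∀ xs Y → P′ (xs ++ Y) ≡ c xs ∧ K′ Y)
liftSlides c ε P split = P , ε , split
liftSlides {p} {K = K} c ((a , b , a≢b , refl) ◅ rest) P split
  with liftSlides c rest (slide (p ↑ʳ a) (p ↑ʳ b) P) (slide-++ P c K split a b)
... | P′ , slides , split′ = P′ , (p ↑ʳ a , p ↑ʳ b , a≢b ∘ FinP.↑ʳ-injective p a b , refl) ◅ slides , split′

lookup-image : ∀ {p q} (σ : Permutation p q) X j → lookup (image σ X) j ≡ lookup X (σ ⟨$⟩ˡ j)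
lookup-image σ X j = VecP.lookup∘tabulate _ j

image-id : ∀ {p} (X : Vector p) → image Perm.id X ≡ X
image-id X = ≐⇒≡ (lookup-image Perm.id X)

image-∘ : ∀ {p q r} (σ : Permutation p q) (τ : Permutation q r) X → image (σ ∘ₚ τ) X ≡ image τ (image σ X)
image-∘ σ τ X = ≐⇒≡ λ j → trans (lookup-image (σ ∘ₚ τ) X j) (sym (trans (lookup-image τ (image σ X) j) (lookup-image σ X (τ ⟨$⟩ˡ j))))

image-lift₀ : ∀ {p q} (σ : Permutation p q) x X → image (lift₀ σ) (x ∷ X) ≡ x ∷ image σ X
image-lift₀ σ x X = ≐⇒≡ λ { zero → refl ; (suc j) → trans (lookup-image (lift₀ σ) (x ∷ X) (suc j)) (sym (lookup-image σ X j)) }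

image-transpose : ∀ {p} x y (Z : Vector p) → image (Perm.transpose zero (suc zero)) (x ∷ y ∷ Z) ≡ y ∷ x ∷ Z
image-transpose x y Z = ≐⇒≡ λ { zero → refl ; (suc zero) → refl ; (suc (suc j)) → lookup-image (Perm.transpose zero (suc zero)) (x ∷ y ∷ Z) (suc (suc j)) }

liftBy : ∀ p {q r} → Permutation q r → Permutation (p + q) (p + r)
liftBy zero    σ = σ
liftBy (suc p) σ = lift₀ (liftBy p σ)

image-liftBy : ∀ p {q r} (σ : Permutation q r) (xs : Vector p) Y → image (liftBy p σ) (xs ++ Y) ≡ xs ++ image σ Y
image-liftBy zero    σ []       Y = refl
image-liftBy (suc p) σ (x ∷ xs) Y = trans (image-lift₀ (liftBy p σ) x (xs ++ Y)) (cong (x ∷_) (image-liftBy p σ xs Y))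

moveFront : ∀ t {r} → Permutation (suc (t + r)) (t + suc r)
moveFront zero    = Perm.id
moveFront (suc t) = Perm.transpose zero (suc zero) ∘ₚ lift₀ (moveFront t)

image-moveFront : ∀ t {r} x (L : Vector t) (R : Vector r) → image (moveFront t) (x ∷ (L ++ R)) ≡ L ++ (x ∷ R)
image-moveFront zero    x []      R = image-id (x ∷ R)
image-moveFront (suc t) x (y ∷ L) R = begin
  image (moveFront (suc t)) (x ∷ y ∷ (L ++ R))                                     ≡⟨ image-∘ (Perm.transpose zero (suc zero)) (lift₀ (moveFront t)) (x ∷ y ∷ (L ++ R)) ⟩
  image (lift₀ (moveFront t)) (image (Perm.transpose zero (suc zero)) (x ∷ y ∷ (L ++ R)))
                                                                                  ≡⟨ cong (image (lift₀ (moveFront t))) (image-transpose x y (L ++ R)) ⟩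
  image (lift₀ (moveFront t)) (y ∷ x ∷ (L ++ R))                                   ≡⟨ image-lift₀ (moveFront t) y (x ∷ (L ++ R)) ⟩
  y ∷ image (moveFront t) (x ∷ (L ++ R))                                           ≡⟨ cong (y ∷_) (image-moveFront t x L R) ⟩
  y ∷ (L ++ (x ∷ R))                                                               ∎
  where open ≡-Reasoning

moveFront₂ : ∀ t {r} → Permutation (suc (suc (t + r))) (t + suc (suc r))
moveFront₂ t = lift₀ (moveFront t) ∘ₚ moveFront t

image-moveFront₂ : ∀ t {r} x y (L : Vector t) (R : Vector r) → image (moveFront₂ t) (x ∷ y ∷ (L ++ R)) ≡ L ++ (x ∷ y ∷ R)
image-moveFront₂ t x y L R = begin
  image (moveFront₂ t) (x ∷ y ∷ (L ++ R))                        ≡⟨ image-∘ (lift₀ (moveFront t)) (moveFront t) (x ∷ y ∷ (L ++ R)) ⟩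
  image (moveFront t) (image (lift₀ (moveFront t)) (x ∷ y ∷ (L ++ R)))
                                                                ≡⟨ cong (image (moveFront t)) (image-lift₀ (moveFront t) x (y ∷ (L ++ R))) ⟩
  image (moveFront t) (x ∷ image (moveFront t) (y ∷ (L ++ R)))   ≡⟨ cong (λ z → image (moveFront t) (x ∷ z)) (image-moveFront t y L R) ⟩
  image (moveFront t) (x ∷ (L ++ (y ∷ R)))                       ≡⟨ image-moveFront t x L (y ∷ R) ⟩
  L ++ (x ∷ y ∷ R)                                               ∎
  where open ≡-Reasoning

moveFrontPast : ∀ t u {r} → Permutation (suc (t + (u + r))) (t + (u + suc r))
moveFrontPast t u = moveFront t ∘ₚ liftBy t (moveFront u)

image-moveFrontPast : ∀ t u {r} x (L : Vector t) (P : Vector u) (R : Vector r) →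
  image (moveFrontPast t u) (x ∷ (L ++ (P ++ R))) ≡ L ++ (P ++ (x ∷ R))
image-moveFrontPast t u x L P R = begin
  image (moveFrontPast t u) (x ∷ (L ++ (P ++ R)))                               ≡⟨ image-∘ (moveFront t) (liftBy t (moveFront u)) (x ∷ (L ++ (P ++ R))) ⟩
  image (liftBy t (moveFront u)) (image (moveFront t) (x ∷ (L ++ (P ++ R))))    ≡⟨ cong (image (liftBy t (moveFront u))) (image-moveFront t x L (P ++ R)) ⟩
  image (liftBy t (moveFront u)) (L ++ (x ∷ (P ++ R)))                          ≡⟨ image-liftBy t (moveFront u) L (x ∷ (P ++ R)) ⟩
  L ++ image (moveFront u) (x ∷ (P ++ R))                                       ≡⟨ cong (L ++_) (image-moveFront u x P R) ⟩
  L ++ (P ++ (x ∷ R))                                                           ∎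
  where open ≡-Reasoning

image-△ : ∀ {n} (σ : Permutation n n) A X → image σ (A △ X) ≡ image σ A △ image σ X
image-△ σ A X = ≐⇒≡ λ j → begin
  lookup (image σ (A △ X)) j                            ≡⟨ lookup-image σ (A △ X) j ⟩
  lookup (A △ X) (σ ⟨$⟩ˡ j)                              ≡⟨ lookup-△ A X (σ ⟨$⟩ˡ j) ⟩
  lookup A (σ ⟨$⟩ˡ j) xor lookup X (σ ⟨$⟩ˡ j)             ≡⟨ sym (cong₂ _xor_ (lookup-image σ A j) (lookup-image σ X j)) ⟩
  lookup (image σ A) j xor lookup (image σ X) j         ≡⟨ sym (lookup-△ (image σ A) (image σ X) j) ⟩
  lookup (image σ A △ image σ X) j                      ∎
  where open ≡-Reasoning

image-⊥ : ∀ {n} (σ : Permutation n n) → image σ ⊥ ≡ ⊥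
image-⊥ σ = ≐⇒≡ λ j → trans (lookup-image σ ⊥ j) (trans (lookup-⊥ (σ ⟨$⟩ˡ j)) (sym (lookup-⊥ j)))

image-flip : ∀ {n} (σ : Permutation n n) Y → image σ (image (Perm.flip σ) Y) ≡ Y
image-flip σ Y = ≐⇒≡ λ j → trans (lookup-image σ (image (Perm.flip σ) Y) j)
                                 (trans (lookup-image (Perm.flip σ) Y (σ ⟨$⟩ˡ j)) (cong (lookup Y) (Perm.inverseʳ σ)))

image-flip′ : ∀ {n} (σ : Permutation n n) X → image (Perm.flip σ) (image σ X) ≡ X
image-flip′ σ X = ≐⇒≡ λ j → trans (lookup-image (Perm.flip σ) (image σ X) j)
                                  (trans (lookup-image σ X (σ ⟨$⟩ʳ j)) (cong (lookup X) (Perm.inverseˡ σ)))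

⟨$⟩ˡ-injective : ∀ {n} (σ : Permutation n n) {p q} → σ ⟨$⟩ˡ p ≡ σ ⟨$⟩ˡ q → p ≡ q
⟨$⟩ˡ-injective σ e = trans (sym (Perm.inverseʳ σ)) (trans (cong (σ ⟨$⟩ʳ_) e) (Perm.inverseʳ σ))

image-update : ∀ {n} (σ : Permutation n n) X a c → image σ (X [ σ ⟨$⟩ˡ a ]≔ c) ≡ image σ X [ a ]≔ c
image-update σ X a c = ≐⇒≡ coordinate
  where
  coordinate : ∀ j → lookup (image σ (X [ σ ⟨$⟩ˡ a ]≔ c)) j ≡ lookup (image σ X [ a ]≔ c) j
  coordinate j with a FinP.≟ j
  ... | yes refl = trans (lookup-image σ (X [ σ ⟨$⟩ˡ a ]≔ c) a)
                         (trans (VecP.lookup∘update (σ ⟨$⟩ˡ a) X c) (sym (VecP.lookup∘update a (image σ X) c)))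
  ... | no  a≢j  = trans (lookup-image σ (X [ σ ⟨$⟩ˡ a ]≔ c) j)
                         (trans (VecP.lookup∘update′ (λ e → a≢j (sym (⟨$⟩ˡ-injective σ e))) X c)
                                (sym (trans (VecP.lookup∘update′ (a≢j ∘ sym) (image σ X) c) (lookup-image σ X j))))

transferSlides : ∀ {n} (σ : Permutation n n) {F B G : Family n} → (∀ X → F X ≡ B (image σ X)) → Slides B G →
  Σ (Family n) λ G′ → Slides F G′ × (∀ X → G′ X ≡ G (image σ X))
transferSlides σ {F} relabel ε = F , ε , relabel
transferSlides σ {F} {B} relabel ((a , b , a≢b , refl) ◅ rest)
  with transferSlides σ {slide (σ ⟨$⟩ˡ a) (σ ⟨$⟩ˡ b) F} relabel′ rest
  where
  relabel′ : ∀ X → slide (σ ⟨$⟩ˡ a) (σ ⟨$⟩ˡ b) F X ≡ slide a b B (image σ X)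
  relabel′ X rewrite lookup-image σ X a | lookup-image σ X b | relabel X
                   | relabel ((X [ σ ⟨$⟩ˡ a ]≔ false) [ σ ⟨$⟩ˡ b ]≔ true)
                   | image-update σ (X [ σ ⟨$⟩ˡ a ]≔ false) b true | image-update σ X a false = refl
... | G′ , slides , relabelled = G′ , (σ ⟨$⟩ˡ a , σ ⟨$⟩ˡ b , a≢b ∘ ⟨$⟩ˡ-injective σ , refl) ◅ slides , relabelled

take-drop-++ : ∀ {p m} (xs : Vector p) (ys : Vector m) → take p (xs ++ ys) ≡ xs × drop p (xs ++ ys) ≡ ys
take-drop-++ {p} xs ys = VecP.++-injective (take p (xs ++ ys)) xs (VecP.take++drop≡id p (xs ++ ys))

D-summands : ∀ i j k L P F → D[ i , j , k ] (L ++ (P ++ F)) ≡ copies i loopFam L ∧ (copies j pairFam P ∧ copies k freeFam F)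
D-summands i j k L P F
  rewrite proj₁ (take-drop-++ L (P ++ F)) | proj₂ (take-drop-++ L (P ++ F)) | proj₁ (take-drop-++ P F) | proj₂ (take-drop-++ P F)
  = refl

pieces : ∀ i j k (W : Vector (i * 1 + (j * 2 + k * 1))) →
  Σ _ λ L → Σ _ λ P → Σ _ λ F → W ≡ L ++ (P ++ F)
pieces i j k W = take (i * 1) W , take (j * 2) rest , drop (j * 2) rest ,
  sym (trans (cong (take (i * 1) W ++_) (VecP.take++drop≡id (j * 2) rest)) (VecP.take++drop≡id (i * 1) W))
  where rest = drop (i * 1) W

SplitsOff : ∀ {p m} → (Vector p → Bool) → Family m → Family (p + m) → Set
SplitsOff c G₁ G = ∀ xs Y → G (xs ++ Y) ≡ c xs ∧ G₁ Y

prepend-loop : ∀ {i j k m} {G₁ : Family m} {G} → SplitsOff loopFam G₁ G →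
  Isomorphic G₁ D[ i , j , k ] → Isomorphic G D[ suc i , j , k ]
prepend-loop {i} {j} {k} {G₁ = G₁} {G} split (τ , iso) = lift₀ τ , λ { (x ∷ Y) → begin
  G (x ∷ Y)                                         ≡⟨ split (x ∷ []) Y ⟩
  loopFam (x ∷ []) ∧ G₁ Y                           ≡⟨ cong (loopFam (x ∷ []) ∧_) (iso Y) ⟩
  loopFam (x ∷ []) ∧ D[ i , j , k ] (image τ Y)     ≡⟨ sym (BP.∧-assoc (loopFam (x ∷ [])) _ _) ⟩
  D[ suc i , j , k ] (x ∷ image τ Y)                ≡⟨ cong D[ suc i , j , k ] (sym (image-lift₀ τ x Y)) ⟩
  D[ suc i , j , k ] (image (lift₀ τ) (x ∷ Y))      ∎ }
  where open ≡-Reasoning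

prepend-pair : ∀ {i j k m} {G₁ : Family m} {G} → SplitsOff pairFam G₁ G →
  Isomorphic G₁ D[ i , j , k ] → Isomorphic G D[ i , suc j , k ]
prepend-pair {i} {j} {k} {G₁ = G₁} {G} split (τ , iso) = σ , λ { (x ∷ y ∷ Y) → at x y Y (pieces i j k (image τ Y)) }
  where
  open ≡-Reasoning
  σ = liftBy 2 τ ∘ₚ moveFront₂ (i * 1)
  rearrange : ∀ c l p f → c ∧ (l ∧ (p ∧ f)) ≡ l ∧ ((c ∧ p) ∧ f)
  rearrange = byTruthTable 4
  at : ∀ x y Y → (Σ _ λ L → Σ _ λ P → Σ _ λ F → image τ Y ≡ L ++ (P ++ F)) →
    G (x ∷ y ∷ Y) ≡ D[ i , suc j , k ] (image σ (x ∷ y ∷ Y))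
  at x y Y (L , P , F , W≡) = begin
    G (x ∷ y ∷ Y)                                                          ≡⟨ split (x ∷ y ∷ []) Y ⟩
    pairFam (x ∷ y ∷ []) ∧ G₁ Y                                            ≡⟨ cong (pairFam (x ∷ y ∷ []) ∧_) (trans (iso Y) (cong D[ i , j , k ] W≡)) ⟩
    pairFam (x ∷ y ∷ []) ∧ D[ i , j , k ] (L ++ (P ++ F))                  ≡⟨ cong (pairFam (x ∷ y ∷ []) ∧_) (D-summands i j k L P F) ⟩
    pairFam (x ∷ y ∷ []) ∧ (copies i loopFam L ∧ (copies j pairFam P ∧ copies k freeFam F))
                                                                           ≡⟨ rearrange (pairFam (x ∷ y ∷ [])) (copies i loopFam L) (copies j pairFam P) (copies k freeFam F) ⟩
    copies i loopFam L ∧ (copies (suc j) pairFam (x ∷ y ∷ P) ∧ copies k freeFam F)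
                                                                           ≡⟨ sym (D-summands i (suc j) k L (x ∷ y ∷ P) F) ⟩
    D[ i , suc j , k ] (L ++ (x ∷ y ∷ (P ++ F)))                           ≡⟨ cong D[ i , suc j , k ] (sym moved) ⟩
    D[ i , suc j , k ] (image σ (x ∷ y ∷ Y))                               ∎
    where
    moved : image σ (x ∷ y ∷ Y) ≡ L ++ (x ∷ y ∷ (P ++ F))
    moved = begin
      image σ (x ∷ y ∷ Y)                                          ≡⟨ image-∘ (liftBy 2 τ) (moveFront₂ (i * 1)) (x ∷ y ∷ Y) ⟩
      image (moveFront₂ (i * 1)) (image (liftBy 2 τ) (x ∷ y ∷ Y))   ≡⟨ cong (image (moveFront₂ (i * 1))) (image-liftBy 2 τ (x ∷ y ∷ []) Y) ⟩
      image (moveFront₂ (i * 1)) (x ∷ y ∷ image τ Y)               ≡⟨ cong (λ W → image (moveFront₂ (i * 1)) (x ∷ y ∷ W)) W≡ ⟩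
      image (moveFront₂ (i * 1)) (x ∷ y ∷ (L ++ (P ++ F)))         ≡⟨ image-moveFront₂ (i * 1) x y L (P ++ F) ⟩
      L ++ (x ∷ y ∷ (P ++ F))                                      ∎

prepend-free : ∀ {i j k m} {G₁ : Family m} {G} → SplitsOff freeFam G₁ G →
  Isomorphic G₁ D[ i , j , k ] → Isomorphic G D[ i , j , suc k ]
prepend-free {i} {j} {k} {G₁ = G₁} {G} split (τ , iso) = σ , λ { (x ∷ Y) → at x Y (pieces i j k (image τ Y)) }
  where
  open ≡-Reasoning
  σ = lift₀ τ ∘ₚ moveFrontPast (i * 1) (j * 2)
  at : ∀ x Y → (Σ _ λ L → Σ _ λ P → Σ _ λ F → image τ Y ≡ L ++ (P ++ F)) →
    G (x ∷ Y) ≡ D[ i , j , suc k ] (image σ (x ∷ Y))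
  at x Y (L , P , F , W≡) = begin
    G (x ∷ Y)                                                  ≡⟨ split (x ∷ []) Y ⟩
    G₁ Y                                                       ≡⟨ trans (iso Y) (cong D[ i , j , k ] W≡) ⟩
    D[ i , j , k ] (L ++ (P ++ F))                             ≡⟨ D-summands i j k L P F ⟩
    copies i loopFam L ∧ (copies j pairFam P ∧ copies k freeFam F)
                                                               ≡⟨ sym (D-summands i j (suc k) L P (x ∷ F)) ⟩
    D[ i , j , suc k ] (L ++ (P ++ (x ∷ F)))                   ≡⟨ cong D[ i , j , suc k ] (sym moved) ⟩
    D[ i , j , suc k ] (image σ (x ∷ Y))                       ∎
    where
    moved : image σ (x ∷ Y) ≡ L ++ (P ++ (x ∷ F))
    moved = begin
      image σ (x ∷ Y)                                             ≡⟨ image-∘ (lift₀ τ) (moveFrontPast (i * 1) (j * 2)) (x ∷ Y) ⟩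
      image (moveFrontPast (i * 1) (j * 2)) (image (lift₀ τ) (x ∷ Y))
                                                                  ≡⟨ cong (image (moveFrontPast (i * 1) (j * 2))) (image-lift₀ τ x Y) ⟩
      image (moveFrontPast (i * 1) (j * 2)) (x ∷ image τ Y)       ≡⟨ cong (λ W → image (moveFrontPast (i * 1) (j * 2)) (x ∷ W)) W≡ ⟩
      image (moveFrontPast (i * 1) (j * 2)) (x ∷ (L ++ (P ++ F))) ≡⟨ image-moveFrontPast (i * 1) (j * 2) x L P F ⟩
      L ++ (P ++ (x ∷ F))                                         ∎

NormalForm : ∀ {n} → Family n → Set
NormalForm {n} B = Σ ℕ λ i → Σ ℕ λ j → Σ ℕ λ k → Σ (Family n) λ G → Slides B G × Isomorphic G D[ i , j , k ]

Reducible : ℕ → Set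
Reducible m = ∀ (B : Family m) (f : Vector m → Vector m) → Linear f → SelfAdjoint f → Represents f B → NormalForm B

record Peeled {p m} (B₀ : Family (p + m)) (c : Vector p → Bool) : Set where
  field
    i j k     : ℕ
    G         : Family (p + m)
    G₁        : Family m
    slides    : Slides B₀ G
    splitsOff : SplitsOff c G₁ G
    iso       : Isomorphic G₁ D[ i , j , k ]

peel : ∀ p {m} {B₀ : Family (p + m)} (st : Reached B₀) (g : Vector p → Vector p) {c : Vector p → Bool} →
  (∀ xs → repMap st (xs ++ ⊥) ≡ g xs ++ ⊥) → (∀ xs → D g xs ≡ c xs) → Reducible m → Peeled B₀ c
peel p st g {c} block D-block reduce = record
  { i = i ; j = j ; k = k ; G = proj₁ lifted ; G₁ = G₁
  ; slides = path st ◅◅ proj₁ (proj₂ lifted) ; splitsOff = proj₂ (proj₂ lifted) ; iso = iso }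
  where
  module Blocks = Split p (isLinear st) (isSelfAdj st) g block
  splits : SplitsOff c (D Blocks.rest) (family st)
  splits xs Y = trans (represents st (xs ++ Y)) (trans (Blocks.D-split xs Y) (cong (_∧ D Blocks.rest Y) (D-block xs)))
  normal = reduce (D Blocks.rest) Blocks.rest Blocks.rest-linear Blocks.rest-selfAdjoint (λ _ → refl)
  i = proj₁ normal
  j = proj₁ (proj₂ normal)
  k = proj₁ (proj₂ (proj₂ normal))
  G₁ = proj₁ (proj₂ (proj₂ (proj₂ normal)))
  iso = proj₂ (proj₂ (proj₂ (proj₂ (proj₂ normal))))
  lifted = liftSlides c (proj₁ (proj₂ (proj₂ (proj₂ (proj₂ normal))))) (family st) splits

finishLoop : ∀ {m} {B₀ : Family (suc m)} → Reducible m → (st : Reached B₀) → repMap st ⁅ zero ⁆ ≡ ⊥ → NormalForm B₀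
finishLoop reduce st column = suc i , j , k , G , slides , prepend-loop {i} {j} {k} {G₁ = G₁} {G} splitsOff iso
  where
  block : ∀ xs → repMap st (xs ++ ⊥) ≡ loopBlock xs ++ ⊥
  block (false ∷ []) = IsZero⇒≡⊥ (linear-⊥ (isLinear st))
  block (true  ∷ []) = column
  open Peeled (peel 1 st loopBlock block loopBlock-D reduce)

finishFree : ∀ {m} {B₀ : Family (suc m)} → Reducible m → (st : Reached B₀) → repMap st ⁅ zero ⁆ ≡ ⁅ zero ⁆ → NormalForm B₀
finishFree reduce st column = i , j , suc k , G , slides , prepend-free {i} {j} {k} {G₁ = G₁} {G} splitsOff iso
  where
  block : ∀ xs → repMap st (xs ++ ⊥) ≡ freeBlock xs ++ ⊥
  block (false ∷ []) = IsZero⇒≡⊥ (linear-⊥ (isLinear st))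
  block (true  ∷ []) = column
  open Peeled (peel 1 st freeBlock block freeBlock-D reduce)

finishPair : ∀ {m} {B₀ : Family (suc (suc m))} → Reducible m → (st : Reached B₀) →
  repMap st ⁅ zero ⁆ ≡ ⁅ suc zero ⁆ → repMap st ⁅ suc zero ⁆ ≡ ⁅ zero ⁆ → NormalForm B₀
finishPair reduce st column₀ column₁ = i , suc j , k , G , slides , prepend-pair {i} {j} {k} {G₁ = G₁} {G} splitsOff iso
  where
  both : true ∷ true ∷ ⊥ ≡ ⁅ zero ⁆ △ ⁅ suc zero ⁆
  both = cong (λ z → true ∷ true ∷ z) (sym (△-self ⊥))
  block : ∀ xs → repMap st (xs ++ ⊥) ≡ pairBlock xs ++ ⊥
  block (false ∷ false ∷ []) = IsZero⇒≡⊥ (linear-⊥ (isLinear st))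
  block (true  ∷ false ∷ []) = column₀
  block (false ∷ true  ∷ []) = column₁
  block (true  ∷ true  ∷ []) = begin
    repMap st (true ∷ true ∷ ⊥)                           ≡⟨ cong (repMap st) both ⟩
    repMap st (⁅ zero ⁆ △ ⁅ suc zero ⁆)                    ≡⟨ linear-△ (isLinear st) ⁅ zero ⁆ ⁅ suc zero ⁆ ⟩
    repMap st ⁅ zero ⁆ △ repMap st ⁅ suc zero ⁆               ≡⟨ cong₂ _△_ column₀ column₁ ⟩
    ⁅ suc zero ⁆ △ ⁅ zero ⁆                             ≡⟨ cong (λ z → true ∷ true ∷ z) (△-self ⊥) ⟩
    true ∷ true ∷ ⊥                                    ∎
    where open ≡-Reasoning
  open Peeled (peel 2 st pairBlock block pairBlock-D reduce)

beyond : ∀ k m → List (Fin (k + m))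
beyond k m = List.map (k ↑ʳ_) (allFin m)

beyond-∈ : ∀ k {m} (j : Fin m) → k ↑ʳ j ∈ beyond k m
beyond-∈ k j = ∈-map⁺ (k ↑ʳ_) (∈-allFin j)

beyond-avoids : ∀ k m {r s : Fin (k + m)} → (∀ j → k ↑ʳ j ≢ r × k ↑ʳ j ≢ s) → All (λ j → j ≢ r × j ≢ s) (beyond k m)
beyond-avoids k m avoid = All.map⁺ (All.universal avoid (allFin m))

-- Entry (0, 0) = 1: clearing row 0 against it leaves a free element.
freeCase : ∀ {m} {B₀ : Family (suc m)} → Reducible m → (st : Reached B₀) → Entry st zero zero ≡ true → NormalForm B₀
freeCase {m} reduce st e00 = finishFree reduce (Cleared.result C) (≐⇒≡ column)
  where
  avoid = beyond-avoids 1 m λ j → (λ ()) , (λ ())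
  C = clearRow st zero zero (beyond 1 m) avoid e00
  0∉ = ∉-All zero avoid proj₁
  column : ∀ i → Entry (Cleared.result C) i zero ≡ lookup ⁅ zero ⁆ i
  column zero    = trans (Cleared.outside C zero zero 0∉ 0∉) e00
  column (suc i) = trans (Entry-sym (Cleared.result C) (suc i) zero)
                         (trans (Cleared.cleared C (suc i) (beyond-∈ 1 i)) (sym (lookup-⊥ i)))

loopCase : ∀ {m} {B₀ : Family (suc m)} → Reducible m → (st : Reached B₀) → (∀ q → Entry st zero q ≡ false) → NormalForm B₀
loopCase reduce st row0 = finishLoop reduce st (≐⇒≡ column)
  where
  column : ∀ i → Entry st i zero ≡ lookup ⊥ i
  column zero    = row0 zero
  column (suc i) = trans (Entry-sym st (suc i) zero) (trans (row0 (suc i)) (sym (lookup-⊥ i)))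

moveToOne : ∀ {m} {B₀ : Family (suc (suc m))} (st : Reached B₀) → Entry st zero zero ≡ false →
  ∀ j → Entry st zero (suc j) ≡ true → Σ (Reached B₀) λ st′ → Entry st′ zero zero ≡ false × Entry st′ zero (suc zero) ≡ true
moveToOne st e00 j e0j with Entry st zero (suc zero) B.≟ true
... | yes e01 = st , e00 , e01
... | no  e01 = slideStep st (suc zero) (suc j) 1≢j ,
                trans (step-unchanged st 1≢j {zero} {zero} (λ ()) (λ ())) e00 ,
                trans (step-column st 1≢j (λ ())) (cong₂ _xor_ (BP.¬-not e01) e0j)
  where
  1≢j : suc zero ≢ suc j
  1≢j refl = e01 e0j

-- With entries (0,0) = 0 and (0,1) = 1: if (1,1) = 1, sliding 0 over 1 makes (0,0) = 1;
-- otherwise clearing row 0 against (0,1) and row 1 against (1,0) leaves a pair.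
pairCase : ∀ {m} {B₀ : Family (suc (suc m))} → Reducible (suc m) → Reducible m → (st : Reached B₀) →
  Entry st zero zero ≡ false → Entry st zero (suc zero) ≡ true → NormalForm B₀
pairCase {m} reduce₁ reduce₀ st e00 e01 with Entry st (suc zero) (suc zero) B.≟ true
... | yes e11 = freeCase reduce₁ (slideStep st zero (suc zero) (λ ()))
                  (trans (step-corner st (λ ())) (cong₂ _xor_ (cong₂ _xor_ e00 e01) (cong₂ _xor_ (trans (Entry-sym st (suc zero) zero) e01) e11)))
... | no  e11 = finishPair reduce₀ st₂ (≐⇒≡ column₀) (≐⇒≡ column₁)
  where
  avoid₀₁ = beyond-avoids 2 m λ j → (λ ()) , (λ ())
  avoid₁₀ = beyond-avoids 2 m λ j → (λ ()) , (λ ())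
  0∉ = ∉-All zero avoid₀₁ proj₁
  1∉ = ∉-All (suc zero) avoid₀₁ proj₂
  C₁ = clearRow st zero (suc zero) (beyond 2 m) avoid₀₁ e01
  st₁ = Cleared.result C₁
  e₁10 : Entry st₁ (suc zero) zero ≡ true
  e₁10 = trans (Cleared.outside C₁ (suc zero) zero 1∉ 0∉) (trans (Entry-sym st (suc zero) zero) e01)
  e₁00 : Entry st₁ zero zero ≡ false
  e₁00 = trans (Cleared.outside C₁ zero zero 0∉ 0∉) e00
  C₂ = clearRow st₁ (suc zero) zero (beyond 2 m) avoid₁₀ e₁10
  st₂ = Cleared.result C₂
  -- row 0 survives the second clearing, since its entry in column 0 vanishes
  row0 : ∀ q → Entry st₂ zero q ≡ Entry st₁ zero q
  row0 q = Cleared.untouched C₂ zero q 0∉ e₁00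
  column₀ : ∀ i → Entry st₂ i zero ≡ lookup ⁅ suc zero ⁆ i
  column₀ zero          = trans (row0 zero) e₁00
  column₀ (suc zero)    = trans (Cleared.outside C₂ (suc zero) zero 1∉ 0∉) e₁10
  column₀ (suc (suc i)) = trans (Entry-sym st₂ (suc (suc i)) zero)
                                (trans (row0 (suc (suc i))) (trans (Cleared.cleared C₁ (suc (suc i)) (beyond-∈ 2 i)) (sym (lookup-⊥ i))))
  column₁ : ∀ i → Entry st₂ i (suc zero) ≡ lookup ⁅ zero ⁆ i
  column₁ zero          = trans (row0 (suc zero)) (trans (Cleared.outside C₁ zero (suc zero) 0∉ 1∉) e01)
  column₁ (suc zero)    = trans (Cleared.outside C₂ (suc zero) (suc zero) 1∉ 1∉)
                                (trans (Cleared.outside C₁ (suc zero) (suc zero) 1∉ 1∉) (BP.¬-not e11))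
  column₁ (suc (suc i)) = trans (Entry-sym st₂ (suc (suc i)) (suc zero))
                                (trans (Cleared.cleared C₂ (suc (suc i)) (beyond-∈ 2 i)) (sym (lookup-⊥ i)))

reducible₁ : Reducible 0 → Reducible 1
reducible₁ reduce₀ B f lin sa rep with Entry (start lin sa rep) zero zero B.≟ true
... | yes e00 = freeCase reduce₀ (start lin sa rep) e00
... | no  e00 = loopCase reduce₀ (start lin sa rep) λ { zero → BP.¬-not e00 }

reducible₂ : ∀ {m} → Reducible (suc m) → Reducible m → Reducible (suc (suc m))
reducible₂ reduce₁ reduce₀ B f lin sa rep with Entry (start lin sa rep) zero zero B.≟ true
... | yes e00 = freeCase reduce₁ (start lin sa rep) e00
... | no  e00 with FinP.any? (λ j → Entry (start lin sa rep) zero (suc j) B.≟ true)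
...   | no  none = loopCase reduce₁ (start lin sa rep) λ { zero → BP.¬-not e00 ; (suc j) → BP.¬-not λ e → none (j , e) }
...   | yes (j , e0j) with moveToOne (start lin sa rep) (BP.¬-not e00) j e0j
...     | st′ , e00′ , e01 = pairCase reduce₁ reduce₀ st′ e00′ e01

reducible : ∀ m → Reducible m
reducible zero          B f lin sa rep = 0 , 0 , 0 , B , ε , Perm.id , λ { [] → trans (rep []) (D-true {f = f} {[]} λ x _ _ ()) }
reducible (suc zero)    = reducible₁ (reducible zero)
reducible (suc (suc m)) = reducible₂ (reducible (suc m)) (reducible m)

open import Algebra.Properties.CommutativeMonoid.Sum GF2.+-commutativeMonoid
  using (sum; ∑-comm; ∑-distrib-+; sum-cong-≗)
open import Algebra.Properties.Semiring.Sum GF2.semiring using (*-distribˡ-sum)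

matrixMap : ∀ {n} → Matrix n → Vector n → Vector n
matrixMap M u = tabulate λ i → rowDot M i u

foldr-xor≡sum : ∀ {n} (g : Fin n → Bool) → foldr′ _xor_ false (tabulate g) ≡ sum g
foldr-xor≡sum {zero}  g = refl
foldr-xor≡sum {suc n} g = cong (g zero xor_) (foldr-xor≡sum (g ∘ suc))

lookup-matrixMap : ∀ {n} (M : Matrix n) u i → lookup (matrixMap M u) i ≡ sum (λ j → M i j ∧ lookup u j)
lookup-matrixMap M u i = trans (VecP.lookup∘tabulate _ i) (foldr-xor≡sum (λ j → M i j ∧ lookup u j))

dot≡sum : ∀ {n} (u v : Vector n) → dot u v ≡ sum (λ i → lookup u i ∧ lookup v i)
dot≡sum []      []      = refl
dot≡sum (x ∷ u) (y ∷ v) = cong ((x ∧ y) xor_) (dot≡sum u v)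

matrixMap-linear : ∀ {n} (M : Matrix n) → Linear (matrixMap M)
matrixMap-linear M = linear λ u w i → begin
  lookup (matrixMap M (u △ w)) i
    ≡⟨ lookup-matrixMap M (u △ w) i ⟩
  sum (λ j → M i j ∧ lookup (u △ w) j)
    ≡⟨ sum-cong-≗ (λ j → trans (cong (M i j ∧_) (lookup-△ u w j)) (BP.∧-distribˡ-xor (M i j) _ _)) ⟩
  sum (λ j → (M i j ∧ lookup u j) xor (M i j ∧ lookup w j))
    ≡⟨ ∑-distrib-+ (λ j → M i j ∧ lookup u j) (λ j → M i j ∧ lookup w j) ⟩
  sum (λ j → M i j ∧ lookup u j) xor sum (λ j → M i j ∧ lookup w j)
    ≡⟨ sym (cong₂ _xor_ (lookup-matrixMap M u i) (lookup-matrixMap M w i)) ⟩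
  lookup (matrixMap M u) i xor lookup (matrixMap M w) i ∎
  where open ≡-Reasoning

matrixMap-selfAdjoint : ∀ {n} (M : Matrix n) → Symmetric M → SelfAdjoint (matrixMap M)
matrixMap-selfAdjoint {n} M sym-M = selfAdjoint λ u w → begin
  dot u (matrixMap M w)
    ≡⟨ expand u w ⟩
  sum (λ i → sum (λ j → lookup u i ∧ (M i j ∧ lookup w j)))
    ≡⟨ ∑-comm (λ i j → lookup u i ∧ (M i j ∧ lookup w j)) ⟩
  sum (λ j → sum (λ i → lookup u i ∧ (M i j ∧ lookup w j)))
    ≡⟨ sum-cong-≗ (λ j → sum-cong-≗ (λ i → swap (lookup u i) (lookup w j) (sym-M i j))) ⟩
  sum (λ j → sum (λ i → lookup w j ∧ (M j i ∧ lookup u i)))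
    ≡⟨ sym (expand w u) ⟩
  dot w (matrixMap M u) ∎
  where
  open ≡-Reasoning
  expand : ∀ u w → dot u (matrixMap M w) ≡ sum (λ i → sum (λ j → lookup u i ∧ (M i j ∧ lookup w j)))
  expand u w = trans (dot≡sum u (matrixMap M w)) (sum-cong-≗ λ i →
    trans (cong (lookup u i ∧_) (lookup-matrixMap M w i)) (*-distribˡ-sum {n} (lookup u i) (λ j → M i j ∧ lookup w j)))
  swap : ∀ x y {m m′} → m ≡ m′ → x ∧ (m ∧ y) ≡ y ∧ (m′ ∧ x)
  swap x y {m} refl = rearrange x m y
    where
    rearrange : ∀ x m y → x ∧ (m ∧ y) ≡ y ∧ (m ∧ x)
    rearrange = byTruthTable 3

nonsingular⇒nonsingularOn : ∀ {n} (M : Matrix n) A → Nonsingular M A → NonsingularOn (matrixMap M) A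
nonsingular⇒nonsingularOn M A ns x s v i =
  trans (cong (λ y → lookup y i) (ns x (λ {j} j∈x → VecP.lookup⇒[]= j A (s j (VecP.[]=⇒lookup j∈x)))
                                       (λ j j∈A → trans (sym (VecP.lookup∘tabulate (λ i → rowDot M i x) j)) (v j (VecP.[]=⇒lookup j∈A)))))
        (lookup-⊥ i)

nonsingularOn⇒nonsingular : ∀ {n} (M : Matrix n) A → NonsingularOn (matrixMap M) A → Nonsingular M A
nonsingularOn⇒nonsingular M A ns x x⊆A v =
  IsZero⇒≡⊥ (ns x (λ j xj → VecP.[]=⇒lookup (x⊆A (VecP.lookup⇒[]= j x xj)))
                 (λ j Aj → trans (VecP.lookup∘tabulate (λ i → rowDot M i x) j) (v j (VecP.lookup⇒[]= j A Aj))))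

≡true-ext : ∀ {b c} → (b ≡ true → c ≡ true) → (c ≡ true → b ≡ true) → b ≡ c
≡true-ext {true}  {true}  _ _ = refl
≡true-ext {false} {false} _ _ = refl
≡true-ext {true}  {false} to _ = sym (to refl)
≡true-ext {false} {true}  _ from = from refl

-- A binary set system with ∅ feasible is, after relabelling, represented by a
-- self-adjoint linear map: pivot the matrix representation of its twist on the
-- twisting set.
binary⇒represented : ∀ {n} (F : Family n) → Binary F → Feasible F ⊥ →
  Σ (Permutation n n) λ σ → Σ (Vector n → Vector n) λ g → Linear g × SelfAdjoint g × (∀ X → F X ≡ D g (image σ X))
binary⇒represented F (A , M , sym-M , σ , twisted) F⊥ = σ , g , pivot-linear lin piv , pivot-selfAdjoint sa piv , represented
  where
  f = matrixMap M
  lin = matrixMap-linear M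
  sa = matrixMap-selfAdjoint M sym-M
  A′ = image σ A
  untwisted : ∀ X → F X ≡ D f (A′ △ image σ X)
  untwisted X = begin
    F X                                ≡⟨ cong F (sym (△-cancelˡ A X)) ⟩
    F (A △ (A △ X))                    ≡⟨ ≡true-ext (λ e → D-true (nonsingular⇒nonsingularOn M _ (Equivalence.to (twisted (A △ X)) e)))
                                                    (λ e → Equivalence.from (twisted (A △ X)) (nonsingularOn⇒nonsingular M _ (D-true⁻¹ e))) ⟩
    D f (image σ (A △ X))              ≡⟨ cong (D f) (image-△ σ A X) ⟩
    D f (A′ △ image σ X)               ∎
    where open ≡-Reasoning
  A′-nonsingular : NonsingularOn f A′
  A′-nonsingular = D-true⁻¹ (begin
    D f A′                     ≡⟨ cong (D f) (sym (△-identityʳ A′)) ⟩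
    D f (A′ △ ⊥)               ≡⟨ cong (λ Z → D f (A′ △ Z)) (sym (image-⊥ σ)) ⟩
    D f (A′ △ image σ ⊥)       ≡⟨ sym (untwisted ⊥) ⟩
    F ⊥                        ≡⟨ F⊥ ⟩
    true                       ∎)
    where open ≡-Reasoning
  piv = proj₂ (pivot-exists lin sa A′ A′-nonsingular)
  g = proj₁ (pivot-exists lin sa A′ A′-nonsingular)
  represented : ∀ X → F X ≡ D g (image σ X)
  represented X = trans (untwisted X) (D-cong (pivot-nonsingular⁻¹ lin piv (image σ X)) (pivot-nonsingular (pivot-linear lin piv) piv (image σ X)))

-- Lemma 3.6.  A binary delta-matroid F in which ∅ is feasible can be taken by handle
-- slides to some D[ i , j , k ].
lemma3p6 : ∀ {n} (F : Family n) → IsDeltaMatroid F → Binary F → Feasible F ⊥ →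
    Σ ℕ λ i → Σ ℕ λ j → Σ ℕ λ k → Σ (Family n) λ G →
      Slides F G × Isomorphic G D[ i , j , k ]
lemma3p6 {n} F _ binary F⊥ = normalise (binary⇒represented F binary F⊥)
  where
  Goal = Σ ℕ λ i → Σ ℕ λ j → Σ ℕ λ k → Σ (Family n) λ G → Slides F G × Isomorphic G D[ i , j , k ]
  normalise : Σ (Permutation n n) (λ σ → Σ (Vector n → Vector n) λ g → Linear g × SelfAdjoint g × (∀ X → F X ≡ D g (image σ X))) → Goal
  normalise (σ , g , lin , sa , represented) = transfer (reducible n B g lin sa representsB)
    where
    B : Family n
    B Y = F (image (Perm.flip σ) Y)
    representsB : Represents g B
    representsB Y = trans (represented (image (Perm.flip σ) Y)) (cong (D g) (image-flip σ Y))
    transfer : NormalForm B → Goal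
    transfer (i , j , k , G , slides , τ , iso) = relabel (transferSlides σ (λ X → cong F (sym (image-flip′ σ X))) slides)
      where
      relabel : (Σ (Family n) λ G′ → Slides F G′ × (∀ X → G′ X ≡ G (image σ X))) → Goal
      relabel (G′ , slides′ , relabelled) =
        i , j , k , G′ , slides′ , σ ∘ₚ τ , λ X → trans (relabelled X) (trans (iso (image σ X)) (cong D[ i , j , k ] (sym (image-∘ σ τ X))))
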